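{- Let $C=(C_1,\ldots,C_m)$ be an equitable partition of the $n$-cube $H^n$ with quotient matrix $S$. Then for all integers $r_1,r_2,r_3$ the vectors $W^{r_1,r_2,r_3}$ satisfy \begin{align*} W^{r_1,r_2,r_3} S''' &= (r_1+1)W^{r_1+1,r_2-1,r_3} + (r_2+1)W^{r_1-1,r_2+1,r_3} + (n-r_1-r_2-r_3+1)W^{r_1,r_2,r_3-1} + (r_3+1)W^{r_1,r_2,r_3+1},\\ W^{r_1,r_2,r_3} S'' &= (r_1+1)W^{r_1+1,r_2,r_3-1} + (r_3+1)W^{r_1-1,r_2,r_3+1} + (n-r_1-r_2-r_3+1)W^{r_1,r_2-1,r_3} + (r_2+1)W^{r_1,r_2+1,r_3},\\ W^{r_1,r_2,r_3} S'^{\mathrm T} &= (r_2+1)W^{r_1,r_2+1,r_3-1} + (r_3+1)W^{r_1,r_2-1,r_3+1} + (n-r_1-r_2-r_3+1)W^{r_1-1,r_2,r_3} + (r_1+1)W^{r_1+1,r_2,r_3}, \end{align*} and the vectors $T^{r_1,r_2,r_3}$ satisfy \begin{align*} T^{r_1,r_2,r_3} S''' &= (r_1+1)T^{r_1+1,r_2-1,r_3} + (r_2+1)T^{r_1-1,r_2+1,r_3} + (n-r_1-r_2-r_3+1)T^{r_1,r_2,r_3-1} + (r_3+1)T^{r_1,r_2,r_3+1},\\ T^{r_1,r_2,r_3} S'' &= (r_1+1)T^{r_1+1,r_2,r_3-1} + (r_3+1)T^{r_1-1,r_2,r_3+1} + (n-r_1-r_2-r_3+1)T^{r_1,r_2-1,r_3}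 + (r_2+1)T^{r_1,r_2+1,r_3},\\ T^{r_1,r_2,r_3} S' &= (r_2+1)T^{r_1,r_2+1,r_3-1} + (r_3+1)T^{r_1,r_2-1,r_3+1} + (n-r_1-r_2-r_3+1)T^{r_1-1,r_2,r_3} + (r_1+1)T^{r_1+1,r_2,r_3}. \end{align*}
   Context: The $n$-cube $H^n$ is the graph whose vertices are the binary words of length $n$, two words adjacent iff they differ in exactly one position; $d$ is the graph (Hamming) distance. An equitable partition of a graph is an ordered partition $C=(C_1,\dots,C_m)$ of its vertex set such that for all $i,j$ every vertex of $C_i$ has the same number $S_{ij}$ of neighbours in $C_j$; $S=(S_{ij})$ is the quotient matrix. For integers $r_1,r_2,r_3$, $T^{r_1,r_2,r_3}_{ijk}$ is the number of triples of vertices $(v,x,y)$ with $v\in C_i$, $x\in C_j$, $y\in C_k$, $d(x,y)=r_2+r_3$, $d(v,y)=r_1+r_3$, $d(v,x)=r_1+r_2$ (so it is $0$ if some $r_\ell<0$ or $r_1+r_2+r_3>n$). For a vertex $v\in C_i$, let $W^{r_1,r_2,r_3}_{ijk}$ be the number of pairs $(x,y)$ with $x\in C_j$, $y\in C_k$ and the same three distance conditions; it is known (strong distance invariance of equitable partitions of $H^n$) that this number does not depend on the choice of $v\in C_i$, so $W^{r_1,r_2,r_3}_{ijk}=T^{r_1,r_2,r_3}_{ijk}/|C_i|$. $W^{r_1,r_2,r_3}$ and $T^{r_1,r_2,r_3}$ are regarded as row vectors of length $m^3$ indexed by $(i,j,k)$. The $m^3\times m^3$ matrices $S',S'',S'''$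 act by $(US')_{ijk}=\sum_{t=1}^m U_{tjk}S_{ti}$, $(US'')_{ijk}=\sum_t U_{itk}S_{tj}$, $(US''')_{ijk}=\sum_t U_{ijt}S_{tk}$ (i.e. $S'=S\otimes I\otimes I$, $S''=I\otimes S\otimes I$, $S'''=I\otimes I\otimes S$), and $S'^{\mathrm T}$ is the transpose of $S'$, i.e. $(US'^{\mathrm T})_{ijk}=\sum_t U_{tjk}S_{it}$. -}

module Defs where

open import Data.Bool using (Bool; true; false; if_then_else_)
open import Data.Nat using (ℕ; zero; suc)
import Data.Nat as ℕ
open import Data.Integer using (ℤ; +_; _+_; _*_)
open import Data.Fin using (Fin; zero; suc)
open import Data.Fin.Properties using () renaming (_≟_ to _≟F_)
open import Data.Vec using (Vec; []; _∷_)
open import Data.List using (List; []; _∷_; _++_; map)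
open import Relation.Binary.PropositionalEquality using (_≡_)
open import Relation.Nullary using (Dec; yes; no)

Word : ℕ → Set
Word n = Vec Bool n

allWords : (n : ℕ) → List (Word n)
allWords zero = [] ∷ []
allWords (suc n) = map (true ∷_) (allWords n) ++ map (false ∷_) (allWords n)

-- Hamming distance (= graph distance in H^n).
dist : {n : ℕ} → Word n → Word n → ℕ
dist [] [] = zero
dist (true ∷ x) (true ∷ y) = dist x y
dist (false ∷ x) (false ∷ y) = dist x y
dist (true ∷ x) (false ∷ y) = suc (dist x y)
dist (false ∷ x) (true ∷ y) = suc (dist x y)

sumL : {A : Set} → List A → (A → ℕ) → ℕ
sumL [] f = zero
sumL (a ∷ as) f = f a ℕ.+ sumL as f

𝟙 : {P : Set} → Dec P → ℕ
𝟙 (yes _) = 1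
𝟙 (no _) = 0

Σ[_]_ : (m : ℕ) → (Fin m → ℤ) → ℤ
Σ[ zero ] f = + 0
Σ[ suc m ] f = f zero + Σ[ m ] (λ t → f (suc t))

nbrsIn : {n m : ℕ} → (Word n → Fin m) → Word n → Fin m → ℕ
nbrsIn {n} col v j =
  sumL (allWords n) (λ x → 𝟙 (dist v x ℕ.≟ 1) ℕ.* 𝟙 (col x ≟F j))

-- An ordered partition of the vertex set of H^n into m cells is given by
-- its cell-assignment map col (C_i = col⁻¹(i)).
IsEquitable : {n m : ℕ} → (Word n → Fin m) → (Fin m → Fin m → ℕ) → Set
IsEquitable col S = ∀ v j → nbrsIn col v j ≡ S (col v) j

DistCond : {n : ℕ} → ℤ → ℤ → ℤ → Word n → Word n → Word n → Set
DistCond r1 r2 r3 v x y =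
  (+ dist x y ≡ r2 + r3) × ((+ dist v y ≡ r1 + r3) × (+ dist v x ≡ r1 + r2))
  where open import Data.Product using (_×_)

open import Data.Product using (_×_; _,_)
open import Data.Integer.Properties using () renaming (_≟_ to _≟ℤ_)
open import Relation.Nullary.Decidable using (_×-dec_)

distCond? : {n : ℕ} → (r1 r2 r3 : ℤ) → (v x y : Word n) → Dec (DistCond r1 r2 r3 v x y)
distCond? r1 r2 r3 v x y =
  ((+ dist x y) ≟ℤ (r2 + r3)) ×-dec (((+ dist v y) ≟ℤ (r1 + r3)) ×-dec ((+ dist v x) ≟ℤ (r1 + r2)))

-- W^{r1,r2,r3}_{ijk} computed at a given vertex v (meant: v ∈ C_i):
-- number of pairs (x,y), x ∈ C_j, y ∈ C_k, satisfying the distance conditions.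
Wat : {n m : ℕ} → (Word n → Fin m) → ℤ → ℤ → ℤ → Word n → Fin m → Fin m → ℤ
Wat {n} col r1 r2 r3 v j k = + sumL (allWords n) (λ x → sumL (allWords n) (λ y →
  𝟙 (col x ≟F j) ℕ.* (𝟙 (col y ≟F k) ℕ.* 𝟙 (distCond? r1 r2 r3 v x y))))

-- W^{r1,r2,r3} as a vector indexed by (i,j,k), using a representative
-- rep i ∈ C_i of each cell.
W : {n m : ℕ} → (Word n → Fin m) → (Fin m → Word n) → ℤ → ℤ → ℤ → Fin m → Fin m → Fin m → ℤ
W col rep r1 r2 r3 i j k = Wat col r1 r2 r3 (rep i) j k

T : {n m : ℕ} → (Word n → Fin m) → ℤ → ℤ → ℤ → Fin m → Fin m → Fin m → ℤ
T {n} col r1 r2 r3 i j k = + sumL (allWords n) (λ v → sumL (allWords n) (λ x → sumL (allWords n) (λ y →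
  𝟙 (col v ≟F i) ℕ.* (𝟙 (col x ≟F j) ℕ.* (𝟙 (col y ≟F k) ℕ.* 𝟙 (distCond? r1 r2 r3 v x y))))))

Vec3 : ℕ → Set
Vec3 m = Fin m → Fin m → Fin m → ℤ

-- Right actions of S' = S⊗I⊗I, S'' = I⊗S⊗I, S''' = I⊗I⊗S and S'^T.
_·S′_ : {m : ℕ} → Vec3 m → (Fin m → Fin m → ℕ) → Vec3 m
_·S′_ {m} U S i j k = Σ[ m ] (λ t → U t j k * + S t i)

_·S″_ : {m : ℕ} → Vec3 m → (Fin m → Fin m → ℕ) → Vec3 m
_·S″_ {m} U S i j k = Σ[ m ] (λ t → U i t k * + S t j)

_·S‴_ : {m : ℕ} → Vec3 m → (Fin m → Fin m → ℕ) → Vec3 m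
_·S‴_ {m} U S i j k = Σ[ m ] (λ t → U i j t * + S t k)

_·S′ᵀ_ : {m : ℕ} → Vec3 m → (Fin m → Fin m → ℕ) → Vec3 m
_·S′ᵀ_ {m} U S i j k = Σ[ m ] (λ t → U t j k * + S i t)

module Submission where

-- Classify each position of a triple (v, x, y) of words by which letter, if any, differs
-- from the other two; the numbers (t₁, t₂, t₃) of positions where v, x, resp. y is the odd
-- one out form the type of the triple, and the distance conditions with parameters
-- (r₁, r₂, r₃) say exactly that the type is (r₁, r₂, r₃). Moving y to a neighbour changes
-- the type in one of four ways, so for fixed v and x the neighbours of z of each type are
-- counted by the type of (v, x, z). Summing this identity over pairs (x, y) in given cells,
-- equitability turns the sum over neighbours into multiplication by S; this yields the
-- relations for W computed at an arbitrary vertex, and, summing over v ∈ Cᵢ, those for T.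
-- For W S′ᵀ one also needs that W at v depends only on the cell of v (strong distance
-- invariance). It follows by induction on r₁ + r₂ + r₃: each relation determines its last
-- term, whose coefficient is nonzero, from terms of lower level.

open import Defs
open import Data.Bool using (Bool; true; false; not)
open import Data.Nat as ℕ using (ℕ; zero; suc; _∸_; s≤s)
import Data.Nat.Properties as ℕ
open import Data.Nat.Tactic.RingSolver using () renaming (solve-∀ to ℕ-solve-∀)
open import Data.Integer using (ℤ; +_; -[1+_]; _+_; _-_; _*_; _≤_; +≤+; -≤+; ∣_∣)
import Data.Integer.Properties as ℤ
open import Data.Integer.Properties using () renaming (_≟_ to _≟ℤ_)
open import Data.Integer.Tactic.RingSolver using (solve-∀)
open import Data.Fin using (Fin; zero; suc)
open import Data.Fin.Properties using (suc-injective) renaming (_≟_ to _≟F_)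
open import Data.Vec using ([]; _∷_)
open import Data.List using (List; []; _∷_; _++_; map; allFin)
open import Data.List.Properties using (map-tabulate)
open import Data.Product using (_×_; _,_)
open import Function using (id; _∘_)
open import Relation.Binary.PropositionalEquality
open import Relation.Nullary using (Dec; yes; no)
open import Relation.Nullary.Decidable using (_×-dec_)
open import Data.Empty using (⊥-elim)
open import Algebra.Bundles using (AbelianGroup)
open import Algebra.Properties.Group (AbelianGroup.group ℤ.+-0-abelianGroup)
  using () renaming (∙-cancelˡ to +-cancelˡ)
open import Algebra.Properties.CommutativeSemigroup ℤ.+-commutativeSemigroup
  using () renaming (interchange to +-interchange)
open import Algebra.Properties.CommutativeSemigroup ℕ.+-commutativeSemigroup
  using () renaming (interchange to +-interchangeℕ)

𝟙-⇔ : {P Q : Set} → (P → Q) → (Q → P) → (p : Dec P) (q : Dec Q) → 𝟙 p ≡ 𝟙 q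
𝟙-⇔ f g (yes _) (yes _) = refl
𝟙-⇔ f g (yes p) (no ¬q) = ⊥-elim (¬q (f p))
𝟙-⇔ f g (no ¬p) (yes q) = ⊥-elim (¬p (g q))
𝟙-⇔ f g (no _)  (no _)  = refl

𝟙-× : {P Q : Set} (p : Dec P) (q : Dec Q) → 𝟙 (p ×-dec q) ≡ 𝟙 p ℕ.* 𝟙 q
𝟙-× (yes _) (yes _) = refl
𝟙-× (yes _) (no _)  = refl
𝟙-× (no _)  _       = refl

private variable
  A B : Set

∑ : List A → (A → ℤ) → ℤ
∑ []       f = + 0
∑ (a ∷ as) f = f a + ∑ as f

infix 5 ∑
syntax ∑ xs (λ x → e) = ∑[ x ∈ xs ] e

∑-cong : (xs : List A) {f g : A → ℤ} → (∀ a → f a ≡ g a) → ∑ xs f ≡ ∑ xs g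
∑-cong []       e = refl
∑-cong (a ∷ as) e = cong₂ _+_ (e a) (∑-cong as e)

∑-zero : (xs : List A) → ∑[ a ∈ xs ] + 0 ≡ + 0
∑-zero []       = refl
∑-zero (a ∷ as) = trans (ℤ.+-identityˡ _) (∑-zero as)

∑-distrib-+ : (xs : List A) (f g : A → ℤ) → ∑[ a ∈ xs ] (f a + g a) ≡ ∑ xs f + ∑ xs g
∑-distrib-+ []       f g = refl
∑-distrib-+ (a ∷ as) f g =
  trans (cong (_+_ (f a + g a)) (∑-distrib-+ as f g)) (+-interchange (f a) (g a) _ _)

*-distribˡ-∑ : ∀ c (xs : List A) (f : A → ℤ) → c * ∑ xs f ≡ ∑[ a ∈ xs ] c * f a
*-distribˡ-∑ c []       f = ℤ.*-zeroʳ c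
*-distribˡ-∑ c (a ∷ as) f =
  trans (ℤ.*-distribˡ-+ c (f a) _) (cong (_+_ (c * f a)) (*-distribˡ-∑ c as f))

*-distribʳ-∑ : ∀ c (xs : List A) (f : A → ℤ) → ∑ xs f * c ≡ ∑[ a ∈ xs ] f a * c
*-distribʳ-∑ c xs f = trans (ℤ.*-comm (∑ xs f) c)
  (trans (*-distribˡ-∑ c xs f) (∑-cong xs (λ a → ℤ.*-comm c (f a))))

∑-comm : (xs : List A) (ys : List B) (f : A → B → ℤ) →
  ∑[ a ∈ xs ] ∑[ b ∈ ys ] f a b ≡ ∑[ b ∈ ys ] ∑[ a ∈ xs ] f a b
∑-comm []       ys f = sym (∑-zero ys)
∑-comm (a ∷ as) ys f = trans (cong (_+_ (∑ ys (f a))) (∑-comm as ys f))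
  (sym (∑-distrib-+ ys (f a) (λ b → ∑[ a′ ∈ as ] f a′ b)))

∑-swap* : (xs : List A) (ys : List B) (a : A → ℤ) (b : B → ℤ) (F : A → B → ℤ) →
  ∑[ x ∈ xs ] a x * (∑[ y ∈ ys ] b y * F x y) ≡ ∑[ y ∈ ys ] b y * (∑[ x ∈ xs ] a x * F x y)
∑-swap* xs ys a b F = begin
    ∑[ x ∈ xs ] a x * (∑[ y ∈ ys ] b y * F x y)
  ≡⟨ ∑-cong xs (λ x → trans (*-distribˡ-∑ (a x) ys _) (∑-cong ys (λ y → exchange (a x) (b y) (F x y)))) ⟩
    ∑[ x ∈ xs ] ∑[ y ∈ ys ] b y * (a x * F x y)
  ≡⟨ ∑-comm xs ys _ ⟩
    ∑[ y ∈ ys ] ∑[ x ∈ xs ] b y * (a x * F x y)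
  ≡⟨ ∑-cong ys (λ y → sym (*-distribˡ-∑ (b y) xs _)) ⟩
    ∑[ y ∈ ys ] b y * (∑[ x ∈ xs ] a x * F x y) ∎
  where
  open ≡-Reasoning
  exchange : ∀ a b c → a * (b * c) ≡ b * (a * c)
  exchange = solve-∀

∑-++ : (xs ys : List A) (f : A → ℤ) → ∑ (xs ++ ys) f ≡ ∑ xs f + ∑ ys f
∑-++ []       ys f = sym (ℤ.+-identityˡ _)
∑-++ (a ∷ as) ys f =
  trans (cong (_+_ (f a)) (∑-++ as ys f)) (sym (ℤ.+-assoc (f a) (∑ as f) (∑ ys f)))

∑-map : (g : B → A) (xs : List B) (f : A → ℤ) → ∑ (map g xs) f ≡ ∑[ b ∈ xs ] f (g b)
∑-map g []       f = refl
∑-map g (b ∷ bs) f = cong (_+_ (f (g b))) (∑-map g bs f)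

pos-sumL : (xs : List A) (f : A → ℕ) → + sumL xs f ≡ ∑[ a ∈ xs ] + f a
pos-sumL []       f = refl
pos-sumL (a ∷ as) f = trans (ℤ.pos-+ (f a) (sumL as f)) (cong (_+_ (+ f a)) (pos-sumL as f))

sumL-cong : (xs : List A) {f g : A → ℕ} → (∀ a → f a ≡ g a) → sumL xs f ≡ sumL xs g
sumL-cong []       e = refl
sumL-cong (a ∷ as) e = cong₂ ℕ._+_ (e a) (sumL-cong as e)

sumL-*ˡ : ∀ c (xs : List A) (f : A → ℕ) → sumL xs (λ a → c ℕ.* f a) ≡ c ℕ.* sumL xs f
sumL-*ˡ c []       f = sym (ℕ.*-zeroʳ c)
sumL-*ˡ c (a ∷ as) f =
  trans (cong (ℕ._+_ (c ℕ.* f a)) (sumL-*ˡ c as f)) (sym (ℕ.*-distribˡ-+ c (f a) (sumL as f)))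

∑-allFin-suc : ∀ m (f : Fin (suc m) → ℤ) → ∑ (allFin (suc m)) f ≡ f zero + (∑[ t ∈ allFin m ] f (suc t))
∑-allFin-suc m f =
  cong (_+_ (f zero)) (trans (cong (λ ts → ∑ ts f) (sym (map-tabulate id suc))) (∑-map suc (allFin m) f))

Σ≡∑ : ∀ m (f : Fin m → ℤ) → Σ[ m ] f ≡ ∑ (allFin m) f
Σ≡∑ zero    f = refl
Σ≡∑ (suc m) f = trans (cong (_+_ (f zero)) (Σ≡∑ m (f ∘ suc))) (sym (∑-allFin-suc m f))

Σ-cong : ∀ m {f g : Fin m → ℤ} → (∀ t → f t ≡ g t) → Σ[ m ] f ≡ Σ[ m ] g
Σ-cong m e = trans (Σ≡∑ m _) (trans (∑-cong (allFin m) e) (sym (Σ≡∑ m _)))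

∑-δ : ∀ m (c : Fin m) (h : Fin m → ℤ) → ∑[ t ∈ allFin m ] + 𝟙 (c ≟F t) * h t ≡ h c
∑-δ (suc m) zero h = begin
    ∑[ t ∈ allFin (suc m) ] + 𝟙 (zero ≟F t) * h t
  ≡⟨ ∑-allFin-suc m (λ t → + 𝟙 (zero ≟F t) * h t) ⟩
    + 1 * h zero + (∑[ t ∈ allFin m ] + 0)
  ≡⟨ cong₂ _+_ (ℤ.*-identityˡ (h zero)) (∑-zero (allFin m)) ⟩
    h zero + + 0
  ≡⟨ ℤ.+-identityʳ (h zero) ⟩
    h zero ∎
  where open ≡-Reasoning
∑-δ (suc m) (suc c) h = begin
    ∑[ t ∈ allFin (suc m) ] + 𝟙 (suc c ≟F t) * h t
  ≡⟨ trans (∑-allFin-suc m (λ t → + 𝟙 (suc c ≟F t) * h t)) (ℤ.+-identityˡ _) ⟩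
    ∑[ t ∈ allFin m ] + 𝟙 (suc c ≟F suc t) * h (suc t)
  ≡⟨ ∑-cong (allFin m) (λ t → cong (λ b → + b * h (suc t))
       (𝟙-⇔ suc-injective (cong suc) (suc c ≟F suc t) (c ≟F t))) ⟩
    ∑[ t ∈ allFin m ] + 𝟙 (c ≟F t) * h (suc t)
  ≡⟨ ∑-δ m c (h ∘ suc) ⟩
    h (suc c) ∎
  where open ≡-Reasoning

-- The cube

∑-allWords-suc : ∀ n (f : Word (suc n) → ℤ) →
  ∑ (allWords (suc n)) f ≡ (∑[ y ∈ allWords n ] f (true ∷ y)) + (∑[ y ∈ allWords n ] f (false ∷ y))
∑-allWords-suc n f = trans (∑-++ (map (true ∷_) (allWords n)) (map (false ∷_) (allWords n)) f)
  (cong₂ _+_ (∑-map (true ∷_) (allWords n) f) (∑-map (false ∷_) (allWords n) f))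

adj : ∀ {n} → Word n → Word n → ℤ
adj x y = + 𝟙 (dist x y ℕ.≟ 1)

δʷ : ∀ {n} → Word n → Word n → ℤ
δʷ x y = + 𝟙 (dist x y ℕ.≟ 0)

dist-sym : ∀ {n} (x y : Word n) → dist x y ≡ dist y x
dist-sym []          []          = refl
dist-sym (true ∷ x)  (true ∷ y)  = dist-sym x y
dist-sym (true ∷ x)  (false ∷ y) = cong suc (dist-sym x y)
dist-sym (false ∷ x) (true ∷ y)  = cong suc (dist-sym x y)
dist-sym (false ∷ x) (false ∷ y) = dist-sym x y

adj-sym : ∀ {n} (x y : Word n) → adj x y ≡ adj y x
adj-sym x y = cong (λ d → + 𝟙 (d ℕ.≟ 1)) (dist-sym x y)

∑-δʷ : ∀ n (z : Word n) (g : Word n → ℤ) → ∑[ y ∈ allWords n ] δʷ z y * g y ≡ g z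
∑-δʷ zero    []          g = trans (ℤ.+-identityʳ _) (ℤ.*-identityˡ (g []))
∑-δʷ (suc n) (true ∷ z)  g = begin
    ∑[ y ∈ allWords (suc n) ] δʷ (true ∷ z) y * g y
  ≡⟨ ∑-allWords-suc n _ ⟩
    (∑[ y ∈ allWords n ] δʷ z y * g (true ∷ y)) + (∑[ y ∈ allWords n ] + 0)
  ≡⟨ cong₂ _+_ (∑-δʷ n z (g ∘ (true ∷_))) (∑-zero (allWords n)) ⟩
    g (true ∷ z) + + 0
  ≡⟨ ℤ.+-identityʳ _ ⟩
    g (true ∷ z) ∎
  where open ≡-Reasoning
∑-δʷ (suc n) (false ∷ z) g = begin
    ∑[ y ∈ allWords (suc n) ] δʷ (false ∷ z) y * g y
  ≡⟨ ∑-allWords-suc n _ ⟩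
    (∑[ y ∈ allWords n ] + 0) + (∑[ y ∈ allWords n ] δʷ z y * g (false ∷ y))
  ≡⟨ cong₂ _+_ (∑-zero (allWords n)) (∑-δʷ n z (g ∘ (false ∷_))) ⟩
    + 0 + g (false ∷ z)
  ≡⟨ ℤ.+-identityˡ _ ⟩
    g (false ∷ z) ∎
  where open ≡-Reasoning

∑-δʷ-suc : ∀ n (z : Word n) (h : Word n → ℤ) →
  ∑[ y ∈ allWords n ] + 𝟙 (suc (dist z y) ℕ.≟ 1) * h y ≡ h z
∑-δʷ-suc n z h = trans (∑-cong (allWords n) (λ y → cong (λ b → + b * h y)
  (𝟙-⇔ ℕ.suc-injective (cong suc) (suc (dist z y) ℕ.≟ 1) (dist z y ℕ.≟ 0)))) (∑-δʷ n z h)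

∑-adj-∷ : ∀ n b (z : Word n) (g : Word (suc n) → ℤ) →
  ∑[ y ∈ allWords (suc n) ] adj (b ∷ z) y * g y
    ≡ (∑[ y ∈ allWords n ] adj z y * g (b ∷ y)) + g (not b ∷ z)
∑-adj-∷ n true z g = trans (∑-allWords-suc n _)
  (cong (_+_ (∑[ y ∈ allWords n ] adj z y * g (true ∷ y))) (∑-δʷ-suc n z (g ∘ (false ∷_))))
∑-adj-∷ n false z g = trans (∑-allWords-suc n _)
  (trans (cong (_+ (∑[ y ∈ allWords n ] adj z y * g (false ∷ y))) (∑-δʷ-suc n z (g ∘ (true ∷_))))
         (ℤ.+-comm (g (true ∷ z)) _))

-- Types of triples of words

data Kind : Set where
  same odd₁ odd₂ odd₃ : Kind

kind : Bool → Bool → Bool → Kind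
kind true  true  true  = same
kind false false false = same
kind true  false false = odd₁
kind false true  true  = odd₁
kind true  false true  = odd₂
kind false true  false = odd₂
kind true  true  false = odd₃
kind false false true  = odd₃

flip₃ : Kind → Kind
flip₃ same = odd₃
flip₃ odd₁ = odd₂
flip₃ odd₂ = odd₁
flip₃ odd₃ = same

infix 5 _≐_
_≐_ : Kind → Kind → ℕ
same ≐ same = 1
odd₁ ≐ odd₁ = 1
odd₂ ≐ odd₂ = 1
odd₃ ≐ odd₃ = 1
_    ≐ _    = 0

count : Kind → ∀ {n} → Word n → Word n → Word n → ℕ
count k []      []      []      = 0
count k (a ∷ v) (b ∷ x) (c ∷ y) = (k ≐ kind a b c) ℕ.+ count k v x y

∀-Bool³ : {P : Bool → Bool → Bool → Set} →
  P true true true → P true true false → P true false true → P true false false →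
  P false true true → P false true false → P false false true → P false false false →
  ∀ a b c → P a b c
∀-Bool³ p₁ p₂ p₃ p₄ p₅ p₆ p₇ p₈ true  true  true  = p₁
∀-Bool³ p₁ p₂ p₃ p₄ p₅ p₆ p₇ p₈ true  true  false = p₂
∀-Bool³ p₁ p₂ p₃ p₄ p₅ p₆ p₇ p₈ true  false true  = p₃
∀-Bool³ p₁ p₂ p₃ p₄ p₅ p₆ p₇ p₈ true  false false = p₄
∀-Bool³ p₁ p₂ p₃ p₄ p₅ p₆ p₇ p₈ false true  true  = p₅
∀-Bool³ p₁ p₂ p₃ p₄ p₅ p₆ p₇ p₈ false true  false = p₆
∀-Bool³ p₁ p₂ p₃ p₄ p₅ p₆ p₇ p₈ false false true  = p₇
∀-Bool³ p₁ p₂ p₃ p₄ p₅ p₆ p₇ p₈ false false false = p₈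

kind-not : ∀ a b c → kind a b (not c) ≡ flip₃ (kind a b c)
kind-not = ∀-Bool³ refl refl refl refl refl refl refl refl

≐-total : ∀ K → (same ≐ K) ℕ.+ (odd₁ ≐ K) ℕ.+ (odd₂ ≐ K) ℕ.+ (odd₃ ≐ K) ≡ 1
≐-total same = refl
≐-total odd₁ = refl
≐-total odd₂ = refl
≐-total odd₃ = refl

count-total : ∀ {n} (v x y : Word n) →
  count same v x y ℕ.+ count odd₁ v x y ℕ.+ count odd₂ v x y ℕ.+ count odd₃ v x y ≡ n
count-total []      []      []      = refl
count-total (a ∷ v) (b ∷ x) (c ∷ y) =
  trans (regroup (same ≐ K) (odd₁ ≐ K) (odd₂ ≐ K) (odd₃ ≐ K)
    (count same v x y) (count odd₁ v x y) (count odd₂ v x y) (count odd₃ v x y))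
    (cong₂ ℕ._+_ (≐-total (kind a b c)) (count-total v x y))
  where
  K = kind a b c
  regroup : ∀ p q r s P Q R S →
    (p ℕ.+ P) ℕ.+ (q ℕ.+ Q) ℕ.+ (r ℕ.+ R) ℕ.+ (s ℕ.+ S) ≡ (p ℕ.+ q ℕ.+ r ℕ.+ s) ℕ.+ (P ℕ.+ Q ℕ.+ R ℕ.+ S)
  regroup = ℕ-solve-∀

dist-count₁₂ : ∀ {n} (v x y : Word n) → dist v x ≡ count odd₁ v x y ℕ.+ count odd₂ v x y
dist-count₁₂ []      []      []      = refl
dist-count₁₂ (a ∷ v) (b ∷ x) (c ∷ y) =
  trans (head a b c) (trans (cong (_ ℕ.+_) (dist-count₁₂ v x y))
    (+-interchangeℕ (odd₁ ≐ kind a b c) (odd₂ ≐ kind a b c) (count odd₁ v x y) (count odd₂ v x y)))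
  where
  head : ∀ a b c → dist (a ∷ v) (b ∷ x) ≡ ((odd₁ ≐ kind a b c) ℕ.+ (odd₂ ≐ kind a b c)) ℕ.+ dist v x
  head = ∀-Bool³ refl refl refl refl refl refl refl refl

dist-count₁₃ : ∀ {n} (v x y : Word n) → dist v y ≡ count odd₁ v x y ℕ.+ count odd₃ v x y
dist-count₁₃ []      []      []      = refl
dist-count₁₃ (a ∷ v) (b ∷ x) (c ∷ y) =
  trans (head a b c) (trans (cong (_ ℕ.+_) (dist-count₁₃ v x y))
    (+-interchangeℕ (odd₁ ≐ kind a b c) (odd₃ ≐ kind a b c) (count odd₁ v x y) (count odd₃ v x y)))
  where
  head : ∀ a b c → dist (a ∷ v) (c ∷ y) ≡ ((odd₁ ≐ kind a b c) ℕ.+ (odd₃ ≐ kind a b c)) ℕ.+ dist v y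
  head = ∀-Bool³ refl refl refl refl refl refl refl refl

dist-count₂₃ : ∀ {n} (v x y : Word n) → dist x y ≡ count odd₂ v x y ℕ.+ count odd₃ v x y
dist-count₂₃ []      []      []      = refl
dist-count₂₃ (a ∷ v) (b ∷ x) (c ∷ y) =
  trans (head a b c) (trans (cong (_ ℕ.+_) (dist-count₂₃ v x y))
    (+-interchangeℕ (odd₂ ≐ kind a b c) (odd₃ ≐ kind a b c) (count odd₂ v x y) (count odd₃ v x y)))
  where
  head : ∀ a b c → dist (b ∷ x) (c ∷ y) ≡ ((odd₂ ≐ kind a b c) ℕ.+ (odd₃ ≐ kind a b c)) ℕ.+ dist x y
  head = ∀-Bool³ refl refl refl refl refl refl refl refl

count-swap₂₃ : ∀ {k k′} → (∀ a b c → k ≐ kind a c b ≡ k′ ≐ kind a b c) →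
  ∀ {n} (v x y : Word n) → count k v y x ≡ count k′ v x y
count-swap₂₃ h []      []      []      = refl
count-swap₂₃ h (a ∷ v) (b ∷ x) (c ∷ y) = cong₂ ℕ._+_ (h a b c) (count-swap₂₃ h v x y)

count-swap₁₃ : ∀ {k k′} → (∀ a b c → k ≐ kind c b a ≡ k′ ≐ kind a b c) →
  ∀ {n} (v x y : Word n) → count k y x v ≡ count k′ v x y
count-swap₁₃ h []      []      []      = refl
count-swap₁₃ h (a ∷ v) (b ∷ x) (c ∷ y) = cong₂ ℕ._+_ (h a b c) (count-swap₁₃ h v x y)

-- Counting neighbours by type

-- combo is opaque so that unification can read off its arguments instead of unfolding _*_.
opaque
  combo : ℤ → ℤ → ℤ → ℤ → ℤ → ℤ → ℤ → ℤ → ℤ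
  combo a b c d p q r s = a * p + b * q + c * r + d * s

opaque
  unfolding combo

  combo-cong : ∀ {a a′ b b′ c c′ d d′ p p′ q q′ r r′ s s′} →
    a ≡ a′ → b ≡ b′ → c ≡ c′ → d ≡ d′ → p ≡ p′ → q ≡ q′ → r ≡ r′ → s ≡ s′ →
    combo a b c d p q r s ≡ combo a′ b′ c′ d′ p′ q′ r′ s′
  combo-cong refl refl refl refl refl refl refl refl = refl

  combo-cong* : ∀ {a a′ b b′ c c′ d d′ p p′ q q′ r r′ s s′} →
    a * p ≡ a′ * p′ → b * q ≡ b′ * q′ → c * r ≡ c′ * r′ → d * s ≡ d′ * s′ →
    combo a b c d p q r s ≡ combo a′ b′ c′ d′ p′ q′ r′ s′
  combo-cong* e₁ e₂ e₃ e₄ = cong₂ _+_ (cong₂ _+_ (cong₂ _+_ e₁ e₂) e₃) e₄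

  ∑*-combo : ∀ a b c d (xs : List A) (w f₁ f₂ f₃ f₄ : A → ℤ) →
    ∑[ x ∈ xs ] w x * combo a b c d (f₁ x) (f₂ x) (f₃ x) (f₄ x)
      ≡ combo a b c d (∑[ x ∈ xs ] w x * f₁ x) (∑[ x ∈ xs ] w x * f₂ x)
                      (∑[ x ∈ xs ] w x * f₃ x) (∑[ x ∈ xs ] w x * f₄ x)
  ∑*-combo a b c d []       w f₁ f₂ f₃ f₄ = nil a b c d
    where
    nil : ∀ a b c d → + 0 ≡ a * + 0 + b * + 0 + c * + 0 + d * + 0
    nil = solve-∀
  ∑*-combo a b c d (x ∷ xs) w f₁ f₂ f₃ f₄ =
    trans (cong (_+_ (w x * combo a b c d (f₁ x) (f₂ x) (f₃ x) (f₄ x))) (∑*-combo a b c d xs w f₁ f₂ f₃ f₄))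
          (cons a b c d (w x) (f₁ x) (f₂ x) (f₃ x) (f₄ x) _ _ _ _)
    where
    cons : ∀ a b c d w p q r s P Q R S →
      w * (a * p + b * q + c * r + d * s) + (a * P + b * Q + c * R + d * S)
        ≡ a * (w * p + P) + b * (w * q + Q) + c * (w * r + R) + d * (w * s + S)
    cons = solve-∀

  combo-injective₄ : ∀ {a b c d p q r s p′ q′ r′ s′} k → d ≡ + suc k →
    combo a b c d p q r s ≡ combo a b c d p′ q′ r′ s′ → p ≡ p′ → q ≡ q′ → r ≡ r′ → s ≡ s′
  combo-injective₄ {a} {b} {c} {p = p} {q} {r} k refl e refl refl refl =
    ℤ.*-cancelˡ-≡ (+ suc k) _ _ (+-cancelˡ (a * p + b * q + c * r) _ _ e)

  unfold-combo : ∀ {a b c d p q r s L} → L ≡ combo a b c d p q r s → L ≡ a * p + b * q + c * r + d * s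
  unfold-combo e = e

  combo-zero : ∀ p q r s → combo (+ 0) (+ 0) (+ 0) (+ 0) p q r s ≡ + 0
  combo-zero p q r s = refl

  combo-swap₁₂ : ∀ a b c d p q r s → combo a b c d p q r s ≡ combo b a c d q p r s
  combo-swap₁₂ = swap
    where
    swap : ∀ a b c d p q r s → a * p + b * q + c * r + d * s ≡ b * q + a * p + c * r + d * s
    swap = solve-∀

  combo-bump₁ : ∀ t b c d p q r s → combo (+ t) b c d p q r s + p ≡ combo (+ suc t) b c d p q r s
  combo-bump₁ t b c d p q r s = bump (+ t) b c d p q r s
    where
    bump : ∀ a b c d p q r s → a * p + b * q + c * r + d * s + p ≡ (+ 1 + a) * p + b * q + c * r + d * s
    bump = solve-∀

  combo-bump₂ : ∀ a t c d p q r s → combo a (+ t) c d p q r s + q ≡ combo a (+ suc t) c d p q r s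
  combo-bump₂ a t c d p q r s = bump a (+ t) c d p q r s
    where
    bump : ∀ a b c d p q r s → a * p + b * q + c * r + d * s + q ≡ a * p + (+ 1 + b) * q + c * r + d * s
    bump = solve-∀

  combo-bump₃ : ∀ a b t d p q r s → combo a b (+ t) d p q r s + r ≡ combo a b (+ suc t) d p q r s
  combo-bump₃ a b t d p q r s = bump a b (+ t) d p q r s
    where
    bump : ∀ a b c d p q r s → a * p + b * q + c * r + d * s + r ≡ a * p + b * q + (+ 1 + c) * r + d * s
    bump = solve-∀

  combo-bump₄ : ∀ a b c t p q r s → combo a b c (+ t) p q r s + s ≡ combo a b c (+ suc t) p q r s
  combo-bump₄ a b c t p q r s = bump a b c (+ t) p q r s
    where
    bump : ∀ a b c d p q r s → a * p + b * q + c * r + d * s + s ≡ a * p + b * q + c * r + (+ 1 + d) * s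
    bump = solve-∀

atType : (ℕ → ℕ → ℕ → ℤ) → ∀ {n} → Word n → Word n → Word n → ℤ
atType f v x y = f (count odd₁ v x y) (count odd₂ v x y) (count odd₃ v x y)

shift : Kind → (ℕ → ℕ → ℕ → ℤ) → ℕ → ℕ → ℕ → ℤ
shift K f t₁ t₂ t₃ = f ((odd₁ ≐ K) ℕ.+ t₁) ((odd₂ ≐ K) ℕ.+ t₂) ((odd₃ ≐ K) ℕ.+ t₃)

-- If (v, x, z) has tₖ positions of each kind, flipping z at one of its t₁ positions of
-- kind odd₁ produces a neighbour y for which that position has kind odd₂, and so on;
-- Λ f t₀ t₁ t₂ t₃ is the resulting sum of f over the types of the neighbours of z.
Λ : (ℕ → ℕ → ℕ → ℤ) → ℕ → ℕ → ℕ → ℕ → ℤ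
Λ f t₀ t₁ t₂ t₃ = combo (+ t₁) (+ t₂) (+ t₀) (+ t₃)
  (f (t₁ ∸ 1) (suc t₂) t₃) (f (suc t₁) (t₂ ∸ 1) t₃) (f t₁ t₂ (suc t₃)) (f t₁ t₂ (t₃ ∸ 1))

*-suc-pred : ∀ t (g : ℕ → ℤ) → + t * g (suc (t ∸ 1)) ≡ + t * g t
*-suc-pred zero    g = refl
*-suc-pred (suc t) g = refl

Λ-shift : ∀ K f t₀ t₁ t₂ t₃ →
  Λ (shift K f) t₀ t₁ t₂ t₃ + shift (flip₃ K) f t₁ t₂ t₃
    ≡ Λ f ((same ≐ K) ℕ.+ t₀) ((odd₁ ≐ K) ℕ.+ t₁) ((odd₂ ≐ K) ℕ.+ t₂) ((odd₃ ≐ K) ℕ.+ t₃)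
Λ-shift same f t₀ t₁ t₂ t₃ = combo-bump₃ _ _ _ _ _ _ _ _
Λ-shift odd₁ f t₀ t₁ t₂ t₃ = trans
  (cong (_+ f t₁ (suc t₂) t₃) (combo-cong* (*-suc-pred t₁ (λ u → f u (suc t₂) t₃)) refl refl refl))
  (combo-bump₁ _ _ _ _ _ _ _ _)
Λ-shift odd₂ f t₀ t₁ t₂ t₃ = trans
  (cong (_+ f (suc t₁) t₂ t₃) (combo-cong* refl (*-suc-pred t₂ (λ u → f (suc t₁) u t₃)) refl refl))
  (combo-bump₂ _ _ _ _ _ _ _ _)
Λ-shift odd₃ f t₀ t₁ t₂ t₃ = trans
  (cong (_+ f t₁ t₂ t₃) (combo-cong* refl refl refl (*-suc-pred t₃ (f t₁ t₂))))
  (combo-bump₄ _ _ _ _ _ _ _ _)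

∑-adj-atType : ∀ {n} f (v x z : Word n) →
  ∑[ y ∈ allWords n ] adj z y * atType f v x y
    ≡ Λ f (count same v x z) (count odd₁ v x z) (count odd₂ v x z) (count odd₃ v x z)
∑-adj-atType f [] [] [] = sym (combo-zero _ _ _ _)
∑-adj-atType {suc n} f (a ∷ v) (b ∷ x) (c ∷ z) = begin
    ∑[ y ∈ allWords (suc n) ] adj (c ∷ z) y * atType f (a ∷ v) (b ∷ x) y
  ≡⟨ ∑-adj-∷ n c z (atType f (a ∷ v) (b ∷ x)) ⟩
    (∑[ y ∈ allWords n ] adj z y * atType (shift K f) v x y) + atType (shift (kind a b (not c)) f) v x z
  ≡⟨ cong₂ _+_ (∑-adj-atType (shift K f) v x z) (cong (λ K′ → atType (shift K′ f) v x z) (kind-not a b c)) ⟩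
    Λ (shift K f) (count same v x z) (count odd₁ v x z) (count odd₂ v x z) (count odd₃ v x z)
      + atType (shift (flip₃ K) f) v x z
  ≡⟨ Λ-shift K f (count same v x z) (count odd₁ v x z) (count odd₂ v x z) (count odd₃ v x z) ⟩
    Λ f (count same (a ∷ v) (b ∷ x) (c ∷ z)) (count odd₁ (a ∷ v) (b ∷ x) (c ∷ z))
        (count odd₂ (a ∷ v) (b ∷ x) (c ∷ z)) (count odd₃ (a ∷ v) (b ∷ x) (c ∷ z)) ∎
  where
  open ≡-Reasoning
  K = kind a b c

δ : ℤ → ℤ → ℤ
δ x y = + 𝟙 (x ≟ℤ y)

δ-coeff : ∀ {c c′} x y → (x ≡ y → c ≡ c′) → c * δ x y ≡ c′ * δ x y
δ-coeff {c} {c′} x y h with x ≟ℤ y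
... | yes e = cong (_* + 1) (h e)
... | no _  = trans (ℤ.*-zeroʳ c) (sym (ℤ.*-zeroʳ c′))

δ-+ˡ : ∀ k x y → δ (k + x) (k + y) ≡ δ x y
δ-+ˡ k x y = cong +_ (𝟙-⇔ (+-cancelˡ k x y) (cong (_+_ k)) (k + x ≟ℤ k + y) (x ≟ℤ y))

δ-+1 : ∀ t r → δ (+ t) r ≡ δ (+ suc t) (r + + 1)
δ-+1 t r = sym (trans (cong (δ (+ suc t)) (ℤ.+-comm r (+ 1))) (δ-+ˡ (+ 1) (+ t) r))

δ-suc : ∀ t r → δ (+ suc t) r ≡ δ (+ t) (r - + 1)
δ-suc t r = trans (cong (δ (+ suc t)) (sym (r-1+1 r))) (sym (δ-+1 t (r - + 1)))
  where
  r-1+1 : ∀ r → r - + 1 + + 1 ≡ r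
  r-1+1 = solve-∀

*-δ-pred : ∀ t r → + t * δ (+ (t ∸ 1)) r ≡ (r + + 1) * δ (+ t) (r + + 1)
*-δ-pred zero    r = sym (δ-coeff (+ 0) (r + + 1) sym)
*-δ-pred (suc t) r = trans (cong (+ suc t *_) (δ-+1 t r)) (δ-coeff (+ suc t) (r + + 1) id)

δ³ : ℤ → ℤ → ℤ → ℕ → ℕ → ℕ → ℤ
δ³ r₁ r₂ r₃ t₁ t₂ t₃ = δ (+ t₁) r₁ * (δ (+ t₂) r₂ * δ (+ t₃) r₃)

δ³-cong : ∀ {r₁ r₂ r₃ t₁ t₂ t₃ s₁ s₂ s₃} → t₁ ≡ s₁ → t₂ ≡ s₂ → t₃ ≡ s₃ →
  δ³ r₁ r₂ r₃ t₁ t₂ t₃ ≡ δ³ r₁ r₂ r₃ s₁ s₂ s₃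
δ³-cong refl refl refl = refl

δ³-swap₂₃ : ∀ r₁ r₂ r₃ t₁ t₂ t₃ → δ³ r₁ r₂ r₃ t₁ t₃ t₂ ≡ δ³ r₁ r₃ r₂ t₁ t₂ t₃
δ³-swap₂₃ r₁ r₂ r₃ t₁ t₂ t₃ = cong (δ (+ t₁) r₁ *_) (ℤ.*-comm (δ (+ t₃) r₂) (δ (+ t₂) r₃))

δ³-swap₁₃ : ∀ r₁ r₂ r₃ t₁ t₂ t₃ → δ³ r₁ r₂ r₃ t₃ t₂ t₁ ≡ δ³ r₃ r₂ r₁ t₁ t₂ t₃
δ³-swap₁₃ r₁ r₂ r₃ t₁ t₂ t₃ = swap (δ (+ t₃) r₁) (δ (+ t₂) r₂) (δ (+ t₁) r₃)
  where
  swap : ∀ a b c → a * (b * c) ≡ c * (b * a)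
  swap = solve-∀

δ³-coeff : ∀ {c c′} r₁ r₂ r₃ t₁ t₂ t₃ → (+ t₁ ≡ r₁ → + t₂ ≡ r₂ → + t₃ ≡ r₃ → c ≡ c′) →
  c * δ³ r₁ r₂ r₃ t₁ t₂ t₃ ≡ c′ * δ³ r₁ r₂ r₃ t₁ t₂ t₃
δ³-coeff {c} {c′} r₁ r₂ r₃ t₁ t₂ t₃ h with + t₁ ≟ℤ r₁ | + t₂ ≟ℤ r₂ | + t₃ ≟ℤ r₃
... | yes e₁ | yes e₂ | yes e₃ = cong (_* + 1) (h e₁ e₂ e₃)
... | yes _  | yes _  | no _   = trans (ℤ.*-zeroʳ c) (sym (ℤ.*-zeroʳ c′))
... | yes _  | no _   | _      = trans (ℤ.*-zeroʳ c) (sym (ℤ.*-zeroʳ c′))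
... | no _   | _      | _      = trans (ℤ.*-zeroʳ c) (sym (ℤ.*-zeroʳ c′))

ofType : ℤ → ℤ → ℤ → ∀ {n} → Word n → Word n → Word n → ℤ
ofType r₁ r₂ r₃ = atType (δ³ r₁ r₂ r₃)

ofType-neg₁ : ∀ {n} a r₂ r₃ (v x y : Word n) → ofType -[1+ a ] r₂ r₃ v x y ≡ + 0
ofType-neg₁ a r₂ r₃ v x y = refl

ofType-neg₂ : ∀ {n} r₁ b r₃ (v x y : Word n) → ofType r₁ -[1+ b ] r₃ v x y ≡ + 0
ofType-neg₂ r₁ b r₃ v x y = ℤ.*-zeroʳ (δ (+ count odd₁ v x y) r₁)

ofType-neg₃ : ∀ {n} r₁ r₂ c (v x y : Word n) → ofType r₁ r₂ -[1+ c ] v x y ≡ + 0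
ofType-neg₃ r₁ r₂ c v x y = trans (cong (δ (+ count odd₁ v x y) r₁ *_) (ℤ.*-zeroʳ (δ (+ count odd₂ v x y) r₂)))
  (ℤ.*-zeroʳ (δ (+ count odd₁ v x y) r₁))

c₀ : ℕ → ℤ → ℤ → ℤ → ℤ
c₀ n r₁ r₂ r₃ = + n - r₁ - r₂ - r₃ + + 1

Λ-δ³ : ∀ n r₁ r₂ r₃ t₀ t₁ t₂ t₃ → t₀ ℕ.+ t₁ ℕ.+ t₂ ℕ.+ t₃ ≡ n →
  Λ (δ³ r₁ r₂ r₃) t₀ t₁ t₂ t₃
    ≡ combo (r₁ + + 1) (r₂ + + 1) (c₀ n r₁ r₂ r₃) (r₃ + + 1)
        (δ³ (r₁ + + 1) (r₂ - + 1) r₃ t₁ t₂ t₃) (δ³ (r₁ - + 1) (r₂ + + 1) r₃ t₁ t₂ t₃)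
        (δ³ r₁ r₂ (r₃ - + 1) t₁ t₂ t₃) (δ³ r₁ r₂ (r₃ + + 1) t₁ t₂ t₃)
Λ-δ³ n r₁ r₂ r₃ t₀ t₁ t₂ t₃ total = combo-cong* first second third fourth
  where
  open ≡-Reasoning
  A₁ = δ (+ t₁) r₁
  A₂ = δ (+ t₂) r₂
  A₃ = δ (+ t₃) r₃

  first : + t₁ * (δ (+ (t₁ ∸ 1)) r₁ * (δ (+ suc t₂) r₂ * A₃))
        ≡ (r₁ + + 1) * (δ (+ t₁) (r₁ + + 1) * (δ (+ t₂) (r₂ - + 1) * A₃))
  first = begin
      + t₁ * (δ (+ (t₁ ∸ 1)) r₁ * (δ (+ suc t₂) r₂ * A₃))
    ≡⟨ sym (ℤ.*-assoc (+ t₁) (δ (+ (t₁ ∸ 1)) r₁) _) ⟩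
      + t₁ * δ (+ (t₁ ∸ 1)) r₁ * (δ (+ suc t₂) r₂ * A₃)
    ≡⟨ cong₂ _*_ (*-δ-pred t₁ r₁) (cong (_* A₃) (δ-suc t₂ r₂)) ⟩
      (r₁ + + 1) * δ (+ t₁) (r₁ + + 1) * (δ (+ t₂) (r₂ - + 1) * A₃)
    ≡⟨ ℤ.*-assoc (r₁ + + 1) (δ (+ t₁) (r₁ + + 1)) _ ⟩
      (r₁ + + 1) * (δ (+ t₁) (r₁ + + 1) * (δ (+ t₂) (r₂ - + 1) * A₃)) ∎

  second : + t₂ * (δ (+ suc t₁) r₁ * (δ (+ (t₂ ∸ 1)) r₂ * A₃))
         ≡ (r₂ + + 1) * (δ (+ t₁) (r₁ - + 1) * (δ (+ t₂) (r₂ + + 1) * A₃))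
  second = begin
      + t₂ * (δ (+ suc t₁) r₁ * (δ (+ (t₂ ∸ 1)) r₂ * A₃))
    ≡⟨ middle (+ t₂) (δ (+ suc t₁) r₁) (δ (+ (t₂ ∸ 1)) r₂) A₃ ⟩
      δ (+ suc t₁) r₁ * (+ t₂ * δ (+ (t₂ ∸ 1)) r₂ * A₃)
    ≡⟨ cong₂ _*_ (δ-suc t₁ r₁) (cong (_* A₃) (*-δ-pred t₂ r₂)) ⟩
      δ (+ t₁) (r₁ - + 1) * ((r₂ + + 1) * δ (+ t₂) (r₂ + + 1) * A₃)
    ≡⟨ sym (middle (r₂ + + 1) (δ (+ t₁) (r₁ - + 1)) (δ (+ t₂) (r₂ + + 1)) A₃) ⟩
      (r₂ + + 1) * (δ (+ t₁) (r₁ - + 1) * (δ (+ t₂) (r₂ + + 1) * A₃)) ∎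
    where
    middle : ∀ c a b d → c * (a * (b * d)) ≡ a * (c * b * d)
    middle = solve-∀

  third : + t₀ * (A₁ * (A₂ * δ (+ suc t₃) r₃))
        ≡ c₀ n r₁ r₂ r₃ * (A₁ * (A₂ * δ (+ t₃) (r₃ - + 1)))
  third = begin
      + t₀ * (A₁ * (A₂ * δ (+ suc t₃) r₃))
    ≡⟨ cong (λ e → + t₀ * (A₁ * (A₂ * e))) (δ-suc t₃ r₃) ⟩
      + t₀ * δ³ r₁ r₂ (r₃ - + 1) t₁ t₂ t₃
    ≡⟨ δ³-coeff r₁ r₂ (r₃ - + 1) t₁ t₂ t₃ (λ e₁ e₂ e₃ →
         trans (solveFor (+ t₀) e₁ e₂ e₃) (cong (λ N → N - r₁ - r₂ - r₃ + + 1) (cong +_ total))) ⟩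
      c₀ n r₁ r₂ r₃ * δ³ r₁ r₂ (r₃ - + 1) t₁ t₂ t₃ ∎
    where
    solveFor : ∀ t₀ {t₁ t₂ t₃} → t₁ ≡ r₁ → t₂ ≡ r₂ → t₃ ≡ r₃ - + 1 →
      t₀ ≡ t₀ + t₁ + t₂ + t₃ - r₁ - r₂ - r₃ + + 1
    solveFor t₀ refl refl refl = ring t₀ r₁ r₂ r₃
      where
      ring : ∀ t₀ r₁ r₂ r₃ → t₀ ≡ t₀ + r₁ + r₂ + (r₃ - + 1) - r₁ - r₂ - r₃ + + 1
      ring = solve-∀

  fourth : + t₃ * (A₁ * (A₂ * δ (+ (t₃ ∸ 1)) r₃))
         ≡ (r₃ + + 1) * (A₁ * (A₂ * δ (+ t₃) (r₃ + + 1)))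
  fourth = begin
      + t₃ * (A₁ * (A₂ * δ (+ (t₃ ∸ 1)) r₃))
    ≡⟨ inner (+ t₃) A₁ A₂ (δ (+ (t₃ ∸ 1)) r₃) ⟩
      A₁ * (A₂ * (+ t₃ * δ (+ (t₃ ∸ 1)) r₃))
    ≡⟨ cong (λ e → A₁ * (A₂ * e)) (*-δ-pred t₃ r₃) ⟩
      A₁ * (A₂ * ((r₃ + + 1) * δ (+ t₃) (r₃ + + 1)))
    ≡⟨ sym (inner (r₃ + + 1) A₁ A₂ (δ (+ t₃) (r₃ + + 1))) ⟩
      (r₃ + + 1) * (A₁ * (A₂ * δ (+ t₃) (r₃ + + 1))) ∎
    where
    inner : ∀ c a b d → c * (a * (b * d)) ≡ a * (b * (c * d))
    inner = solve-∀

∑-adj-ofType₃ : ∀ {n} r₁ r₂ r₃ (v x z : Word n) →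
  ∑[ y ∈ allWords n ] adj z y * ofType r₁ r₂ r₃ v x y
    ≡ combo (r₁ + + 1) (r₂ + + 1) (c₀ n r₁ r₂ r₃) (r₃ + + 1)
        (ofType (r₁ + + 1) (r₂ - + 1) r₃ v x z) (ofType (r₁ - + 1) (r₂ + + 1) r₃ v x z)
        (ofType r₁ r₂ (r₃ - + 1) v x z) (ofType r₁ r₂ (r₃ + + 1) v x z)
∑-adj-ofType₃ {n} r₁ r₂ r₃ v x z = trans (∑-adj-atType (δ³ r₁ r₂ r₃) v x z)
  (Λ-δ³ n r₁ r₂ r₃ (count same v x z) (count odd₁ v x z) (count odd₂ v x z) (count odd₃ v x z)
    (count-total v x z))

ofType-swap₂₃ : ∀ {n} r₁ r₂ r₃ (v x y : Word n) → ofType r₁ r₂ r₃ v y x ≡ ofType r₁ r₃ r₂ v x y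
ofType-swap₂₃ r₁ r₂ r₃ v x y = trans (δ³-cong {r₁} {r₂} {r₃} c₁ c₂ c₃)
  (δ³-swap₂₃ r₁ r₂ r₃ (count odd₁ v x y) (count odd₂ v x y) (count odd₃ v x y))
  where
  c₁ : count odd₁ v y x ≡ count odd₁ v x y
  c₁ = count-swap₂₃ (∀-Bool³ refl refl refl refl refl refl refl refl) v x y
  c₂ : count odd₂ v y x ≡ count odd₃ v x y
  c₂ = count-swap₂₃ (∀-Bool³ refl refl refl refl refl refl refl refl) v x y
  c₃ : count odd₃ v y x ≡ count odd₂ v x y
  c₃ = count-swap₂₃ (∀-Bool³ refl refl refl refl refl refl refl refl) v x y

ofType-swap₁₃ : ∀ {n} r₁ r₂ r₃ (v x y : Word n) → ofType r₁ r₂ r₃ y x v ≡ ofType r₃ r₂ r₁ v x y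
ofType-swap₁₃ r₁ r₂ r₃ v x y = trans (δ³-cong {r₁} {r₂} {r₃} c₁ c₂ c₃)
  (δ³-swap₁₃ r₁ r₂ r₃ (count odd₁ v x y) (count odd₂ v x y) (count odd₃ v x y))
  where
  c₁ : count odd₁ y x v ≡ count odd₃ v x y
  c₁ = count-swap₁₃ (∀-Bool³ refl refl refl refl refl refl refl refl) v x y
  c₂ : count odd₂ y x v ≡ count odd₂ v x y
  c₂ = count-swap₁₃ (∀-Bool³ refl refl refl refl refl refl refl refl) v x y
  c₃ : count odd₃ y x v ≡ count odd₁ v x y
  c₃ = count-swap₁₃ (∀-Bool³ refl refl refl refl refl refl refl refl) v x y

∑-adj-ofType₂ : ∀ {n} r₁ r₂ r₃ (v y z : Word n) →
  ∑[ x ∈ allWords n ] adj z x * ofType r₁ r₂ r₃ v x y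
    ≡ combo (r₁ + + 1) (r₃ + + 1) (c₀ n r₁ r₂ r₃) (r₂ + + 1)
        (ofType (r₁ + + 1) r₂ (r₃ - + 1) v z y) (ofType (r₁ - + 1) r₂ (r₃ + + 1) v z y)
        (ofType r₁ (r₂ - + 1) r₃ v z y) (ofType r₁ (r₂ + + 1) r₃ v z y)
∑-adj-ofType₂ {n} r₁ r₂ r₃ v y z = begin
    ∑[ x ∈ allWords n ] adj z x * ofType r₁ r₂ r₃ v x y
  ≡⟨ ∑-cong (allWords n) (λ x → cong (adj z x *_) (ofType-swap₂₃ r₁ r₂ r₃ v y x)) ⟩
    ∑[ x ∈ allWords n ] adj z x * ofType r₁ r₃ r₂ v y x
  ≡⟨ ∑-adj-ofType₃ r₁ r₃ r₂ v y z ⟩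
    combo (r₁ + + 1) (r₃ + + 1) (c₀ n r₁ r₃ r₂) (r₂ + + 1)
      (ofType (r₁ + + 1) (r₃ - + 1) r₂ v y z) (ofType (r₁ - + 1) (r₃ + + 1) r₂ v y z)
      (ofType r₁ r₃ (r₂ - + 1) v y z) (ofType r₁ r₃ (r₂ + + 1) v y z)
  ≡⟨ combo-cong refl refl (c₀-swap (+ n) r₁ r₂ r₃) refl
       (ofType-swap₂₃ (r₁ + + 1) (r₃ - + 1) r₂ v z y) (ofType-swap₂₃ (r₁ - + 1) (r₃ + + 1) r₂ v z y)
       (ofType-swap₂₃ r₁ r₃ (r₂ - + 1) v z y) (ofType-swap₂₃ r₁ r₃ (r₂ + + 1) v z y) ⟩
    combo (r₁ + + 1) (r₃ + + 1) (c₀ n r₁ r₂ r₃) (r₂ + + 1)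
      (ofType (r₁ + + 1) r₂ (r₃ - + 1) v z y) (ofType (r₁ - + 1) r₂ (r₃ + + 1) v z y)
      (ofType r₁ (r₂ - + 1) r₃ v z y) (ofType r₁ (r₂ + + 1) r₃ v z y) ∎
  where
  open ≡-Reasoning
  c₀-swap : ∀ N r₁ r₂ r₃ → N - r₁ - r₃ - r₂ + + 1 ≡ N - r₁ - r₂ - r₃ + + 1
  c₀-swap = solve-∀

∑-adj-ofType₁ : ∀ {n} r₁ r₂ r₃ (x y z : Word n) →
  ∑[ u ∈ allWords n ] adj z u * ofType r₁ r₂ r₃ u x y
    ≡ combo (r₂ + + 1) (r₃ + + 1) (c₀ n r₁ r₂ r₃) (r₁ + + 1)
        (ofType r₁ (r₂ + + 1) (r₃ - + 1) z x y) (ofType r₁ (r₂ - + 1) (r₃ + + 1) z x y)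
        (ofType (r₁ - + 1) r₂ r₃ z x y) (ofType (r₁ + + 1) r₂ r₃ z x y)
∑-adj-ofType₁ {n} r₁ r₂ r₃ x y z = begin
    ∑[ u ∈ allWords n ] adj z u * ofType r₁ r₂ r₃ u x y
  ≡⟨ ∑-cong (allWords n) (λ u → cong (adj z u *_) (sym (ofType-swap₁₃ r₃ r₂ r₁ u x y))) ⟩
    ∑[ u ∈ allWords n ] adj z u * ofType r₃ r₂ r₁ y x u
  ≡⟨ ∑-adj-ofType₃ r₃ r₂ r₁ y x z ⟩
    combo (r₃ + + 1) (r₂ + + 1) (c₀ n r₃ r₂ r₁) (r₁ + + 1)
      (ofType (r₃ + + 1) (r₂ - + 1) r₁ y x z) (ofType (r₃ - + 1) (r₂ + + 1) r₁ y x z)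
      (ofType r₃ r₂ (r₁ - + 1) y x z) (ofType r₃ r₂ (r₁ + + 1) y x z)
  ≡⟨ combo-cong refl refl (c₀-reverse (+ n) r₁ r₂ r₃) refl
       (ofType-swap₁₃ (r₃ + + 1) (r₂ - + 1) r₁ z x y) (ofType-swap₁₃ (r₃ - + 1) (r₂ + + 1) r₁ z x y)
       (ofType-swap₁₃ r₃ r₂ (r₁ - + 1) z x y) (ofType-swap₁₃ r₃ r₂ (r₁ + + 1) z x y) ⟩
    combo (r₃ + + 1) (r₂ + + 1) (c₀ n r₁ r₂ r₃) (r₁ + + 1)
      (ofType r₁ (r₂ - + 1) (r₃ + + 1) z x y) (ofType r₁ (r₂ + + 1) (r₃ - + 1) z x y)
      (ofType (r₁ - + 1) r₂ r₃ z x y) (ofType (r₁ + + 1) r₂ r₃ z x y)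
  ≡⟨ combo-swap₁₂ _ _ _ _ _ _ _ _ ⟩
    combo (r₂ + + 1) (r₃ + + 1) (c₀ n r₁ r₂ r₃) (r₁ + + 1)
      (ofType r₁ (r₂ + + 1) (r₃ - + 1) z x y) (ofType r₁ (r₂ - + 1) (r₃ + + 1) z x y)
      (ofType (r₁ - + 1) r₂ r₃ z x y) (ofType (r₁ + + 1) r₂ r₃ z x y) ∎
  where
  open ≡-Reasoning
  c₀-reverse : ∀ N r₁ r₂ r₃ → N - r₃ - r₂ - r₁ + + 1 ≡ N - r₁ - r₂ - r₃ + + 1
  c₀-reverse = solve-∀

solve-pair-sums : ∀ {x y z a b c : ℤ} → y + z ≡ b + c → x + z ≡ a + c → x + y ≡ a + b →
  x ≡ a × (y ≡ b × z ≡ c)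
solve-pair-sums {x} {y} {z} {a} {b} {c} yz xz xy = x≡a , (+-cancelˡ a y b (subst (λ u → u + y ≡ a + b) x≡a xy) ,
                                                        +-cancelˡ a z c (subst (λ u → u + z ≡ a + c) x≡a xz))
  where
  twice : ∀ x y z → + 2 * x ≡ (x + z) + (x + y) - (y + z)
  twice = solve-∀
  x≡a : x ≡ a
  x≡a = ℤ.*-cancelˡ-≡ (+ 2) x a (begin
      + 2 * x                         ≡⟨ twice x y z ⟩
      (x + z) + (x + y) - (y + z)     ≡⟨ cong₂ (λ p q → p + q - (y + z)) xz xy ⟩
      (a + c) + (a + b) - (y + z)     ≡⟨ cong ((a + c) + (a + b) -_) yz ⟩
      (a + c) + (a + b) - (b + c)     ≡⟨ sym (twice a b c) ⟩
      + 2 * a                         ∎)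
    where open ≡-Reasoning

𝟙-distCond : ∀ {n} r₁ r₂ r₃ (v x y : Word n) → + 𝟙 (distCond? r₁ r₂ r₃ v x y) ≡ ofType r₁ r₂ r₃ v x y
𝟙-distCond r₁ r₂ r₃ v x y = begin
    + 𝟙 (distCond? r₁ r₂ r₃ v x y)
  ≡⟨ cong +_ (𝟙-⇔ types distances (distCond? r₁ r₂ r₃ v x y) (d₁ ×-dec (d₂ ×-dec d₃))) ⟩
    + 𝟙 (d₁ ×-dec (d₂ ×-dec d₃))
  ≡⟨ cong +_ (trans (𝟙-× d₁ (d₂ ×-dec d₃)) (cong (ℕ._*_ (𝟙 d₁)) (𝟙-× d₂ d₃))) ⟩
    + (𝟙 d₁ ℕ.* (𝟙 d₂ ℕ.* 𝟙 d₃))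
  ≡⟨ trans (ℤ.pos-* (𝟙 d₁) _) (cong (_*_ (+ 𝟙 d₁)) (ℤ.pos-* (𝟙 d₂) (𝟙 d₃))) ⟩
    ofType r₁ r₂ r₃ v x y ∎
  where
  open ≡-Reasoning
  t₁ = + count odd₁ v x y
  t₂ = + count odd₂ v x y
  t₃ = + count odd₃ v x y
  d₁ = t₁ ≟ℤ r₁
  d₂ = t₂ ≟ℤ r₂
  d₃ = t₃ ≟ℤ r₃
  xy : + dist x y ≡ t₂ + t₃
  xy = cong +_ (dist-count₂₃ v x y)
  vy : + dist v y ≡ t₁ + t₃
  vy = cong +_ (dist-count₁₃ v x y)
  vx : + dist v x ≡ t₁ + t₂
  vx = cong +_ (dist-count₁₂ v x y)
  types : DistCond r₁ r₂ r₃ v x y → t₁ ≡ r₁ × (t₂ ≡ r₂ × t₃ ≡ r₃)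
  types (e₁ , e₂ , e₃) = solve-pair-sums (trans (sym xy) e₁) (trans (sym vy) e₂) (trans (sym vx) e₃)
  distances : t₁ ≡ r₁ × (t₂ ≡ r₂ × t₃ ≡ r₃) → DistCond r₁ r₂ r₃ v x y
  distances (e₁ , e₂ , e₃) =
    trans xy (cong₂ _+_ e₂ e₃) , trans vy (cong₂ _+_ e₁ e₃) , trans vx (cong₂ _+_ e₁ e₂)

-- Equitable partitions

module Equitable {n m : ℕ} (col : Word n → Fin m) (S : Fin m → Fin m → ℕ) (equitable : IsEquitable col S) where

  cube : List (Word n)
  cube = allWords n

  cell : Fin m → Word n → ℤ
  cell j x = + 𝟙 (col x ≟F j)

  S-as-∑ : ∀ y k → + S (col y) k ≡ ∑[ z ∈ cube ] adj y z * cell k z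
  S-as-∑ y k = trans (cong +_ (sym (equitable y k)))
    (trans (pos-sumL cube _) (∑-cong cube (λ z → ℤ.pos-* (𝟙 (dist y z ℕ.≟ 1)) _)))

  ∑-quotient : ∀ (g : Word n → ℤ) k →
    Σ[ m ] (λ t → (∑[ y ∈ cube ] cell t y * g y) * + S t k)
      ≡ ∑[ z ∈ cube ] cell k z * (∑[ y ∈ cube ] adj z y * g y)
  ∑-quotient g k = begin
      Σ[ m ] (λ t → (∑[ y ∈ cube ] cell t y * g y) * + S t k)
    ≡⟨ Σ≡∑ m _ ⟩
      ∑[ t ∈ allFin m ] (∑[ y ∈ cube ] cell t y * g y) * + S t k
    ≡⟨ ∑-cong (allFin m) (λ t → trans (*-distribʳ-∑ (+ S t k) cube _)
         (∑-cong cube (λ y → ℤ.*-assoc (cell t y) (g y) (+ S t k)))) ⟩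
      ∑[ t ∈ allFin m ] ∑[ y ∈ cube ] cell t y * (g y * + S t k)
    ≡⟨ ∑-comm (allFin m) cube _ ⟩
      ∑[ y ∈ cube ] ∑[ t ∈ allFin m ] cell t y * (g y * + S t k)
    ≡⟨ ∑-cong cube (λ y → ∑-δ m (col y) (λ t → g y * + S t k)) ⟩
      ∑[ y ∈ cube ] g y * + S (col y) k
    ≡⟨ ∑-cong cube (λ y → cong (g y *_) (trans (S-as-∑ y k)
         (∑-cong cube (λ z → ℤ.*-comm (adj y z) (cell k z))))) ⟩
      ∑[ y ∈ cube ] g y * (∑[ z ∈ cube ] cell k z * adj y z)
    ≡⟨ ∑-swap* cube cube g (cell k) adj ⟩
      ∑[ z ∈ cube ] cell k z * (∑[ y ∈ cube ] g y * adj y z)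
    ≡⟨ ∑-cong cube (λ z → cong (cell k z *_) (∑-cong cube (λ y →
         trans (ℤ.*-comm (g y) (adj y z)) (cong (_* g y) (adj-sym y z))))) ⟩
      ∑[ z ∈ cube ] cell k z * (∑[ y ∈ cube ] adj z y * g y) ∎
    where open ≡-Reasoning

  ∑-adj-cellwise : ∀ v (F : Word n → ℤ) (h : Fin m → ℤ) → (∀ u → F u ≡ h (col u)) →
    ∑[ u ∈ cube ] adj v u * F u ≡ Σ[ m ] (λ t → h t * + S (col v) t)
  ∑-adj-cellwise v F h F≡h = begin
      ∑[ u ∈ cube ] adj v u * F u
    ≡⟨ ∑-cong cube (λ u → cong (adj v u *_) (trans (F≡h u) (sym (trans
         (∑-cong (allFin m) (λ t → ℤ.*-comm (h t) (cell t u))) (∑-δ m (col u) h))))) ⟩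
      ∑[ u ∈ cube ] adj v u * (∑[ t ∈ allFin m ] h t * cell t u)
    ≡⟨ ∑-swap* cube (allFin m) (adj v) h (λ u t → cell t u) ⟩
      ∑[ t ∈ allFin m ] h t * (∑[ u ∈ cube ] adj v u * cell t u)
    ≡⟨ ∑-cong (allFin m) (λ t → cong (h t *_) (sym (S-as-∑ v t))) ⟩
      ∑[ t ∈ allFin m ] h t * + S (col v) t
    ≡⟨ sym (Σ≡∑ m _) ⟩
      Σ[ m ] (λ t → h t * + S (col v) t) ∎
    where open ≡-Reasoning

  pairSum : Fin m → Fin m → (Word n → Word n → ℤ) → ℤ
  pairSum j k F = ∑[ x ∈ cube ] cell j x * (∑[ y ∈ cube ] cell k y * F x y)

  pairSum-cong : ∀ j k {F G : Word n → Word n → ℤ} → (∀ x y → F x y ≡ G x y) → pairSum j k F ≡ pairSum j k G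
  pairSum-cong j k e = ∑-cong cube (λ x → cong (cell j x *_) (∑-cong cube (λ y → cong (cell k y *_) (e x y))))

  pairSum-combo : ∀ j k a b c d (F₁ F₂ F₃ F₄ : Word n → Word n → ℤ) →
    pairSum j k (λ x y → combo a b c d (F₁ x y) (F₂ x y) (F₃ x y) (F₄ x y))
      ≡ combo a b c d (pairSum j k F₁) (pairSum j k F₂) (pairSum j k F₃) (pairSum j k F₄)
  pairSum-combo j k a b c d F₁ F₂ F₃ F₄ =
    trans (∑-cong cube (λ x → cong (cell j x *_) (∑*-combo a b c d cube (cell k) (F₁ x) (F₂ x) (F₃ x) (F₄ x))))
          (∑*-combo a b c d cube (cell j) _ _ _ _)

  ∑-pairSum : ∀ (w : Word n → ℤ) j k (G : Word n → Word n → Word n → ℤ) →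
    ∑[ u ∈ cube ] w u * pairSum j k (G u) ≡ pairSum j k (λ x y → ∑[ u ∈ cube ] w u * G u x y)
  ∑-pairSum w j k G = trans (∑-swap* cube cube w (cell j) _)
    (∑-cong cube (λ x → cong (cell j x *_) (∑-swap* cube cube w (cell k) (λ u y → G u x y))))

  Σ-pairSum₂ : ∀ j k (F : Word n → Word n → ℤ) →
    Σ[ m ] (λ t → pairSum t k F * + S t j) ≡ pairSum j k (λ z y → ∑[ x ∈ cube ] adj z x * F x y)
  Σ-pairSum₂ j k F = trans (∑-quotient (λ x → ∑[ y ∈ cube ] cell k y * F x y) j)
    (∑-cong cube (λ z → cong (cell j z *_) (∑-swap* cube cube (adj z) (cell k) F)))

  Σ-pairSum₃ : ∀ j k (F : Word n → Word n → ℤ) →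
    Σ[ m ] (λ t → pairSum j t F * + S t k) ≡ pairSum j k (λ x z → ∑[ y ∈ cube ] adj z y * F x y)
  Σ-pairSum₃ j k F = begin
      Σ[ m ] (λ t → pairSum j t F * + S t k)
    ≡⟨ Σ-cong m (λ t → cong (_* + S t k) (∑-swap* cube cube (cell j) (cell t) F)) ⟩
      Σ[ m ] (λ t → pairSum t j (λ y x → F x y) * + S t k)
    ≡⟨ Σ-pairSum₂ k j (λ y x → F x y) ⟩
      pairSum k j (λ z x → ∑[ y ∈ cube ] adj z y * F x y)
    ≡⟨ ∑-swap* cube cube (cell k) (cell j) _ ⟩
      pairSum j k (λ x z → ∑[ y ∈ cube ] adj z y * F x y) ∎
    where open ≡-Reasoning

  Wat-as-pairSum : ∀ r₁ r₂ r₃ v j k → Wat col r₁ r₂ r₃ v j k ≡ pairSum j k (ofType r₁ r₂ r₃ v)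
  Wat-as-pairSum r₁ r₂ r₃ v j k = trans (pos-sumL cube _) (∑-cong cube (λ x →
    trans (cong +_ (sumL-*ˡ (𝟙 (col x ≟F j)) cube _)) (trans (ℤ.pos-* (𝟙 (col x ≟F j)) _)
      (cong (cell j x *_) (trans (pos-sumL cube _) (∑-cong cube (λ y →
        trans (ℤ.pos-* (𝟙 (col y ≟F k)) _) (cong (cell k y *_) (𝟙-distCond r₁ r₂ r₃ v x y)))))))))

  T-as-∑ : ∀ r₁ r₂ r₃ i j k → T col r₁ r₂ r₃ i j k ≡ ∑[ v ∈ cube ] cell i v * Wat col r₁ r₂ r₃ v j k
  T-as-∑ r₁ r₂ r₃ i j k = trans (pos-sumL cube _) (∑-cong cube (λ v → trans
    (cong +_ (trans (sumL-cong cube (λ x → sumL-*ˡ (𝟙 (col v ≟F i)) cube _)) (sumL-*ˡ (𝟙 (col v ≟F i)) cube _)))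
    (ℤ.pos-* (𝟙 (col v ≟F i)) _)))

  Wat-combo : ∀ {a b c d} v j k p₁ p₂ p₃ q₁ q₂ q₃ s₁ s₂ s₃ u₁ u₂ u₃ →
    pairSum j k (λ x y → combo a b c d (ofType p₁ p₂ p₃ v x y) (ofType q₁ q₂ q₃ v x y)
                                       (ofType s₁ s₂ s₃ v x y) (ofType u₁ u₂ u₃ v x y))
      ≡ combo a b c d (Wat col p₁ p₂ p₃ v j k) (Wat col q₁ q₂ q₃ v j k)
                      (Wat col s₁ s₂ s₃ v j k) (Wat col u₁ u₂ u₃ v j k)
  Wat-combo {a} {b} {c} {d} v j k p₁ p₂ p₃ q₁ q₂ q₃ s₁ s₂ s₃ u₁ u₂ u₃ =
    trans (pairSum-combo j k a b c d _ _ _ _) (sym (combo-cong refl refl refl refl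
      (Wat-as-pairSum p₁ p₂ p₃ v j k) (Wat-as-pairSum q₁ q₂ q₃ v j k)
      (Wat-as-pairSum s₁ s₂ s₃ v j k) (Wat-as-pairSum u₁ u₂ u₃ v j k)))

  Wat-S‴ : ∀ r₁ r₂ r₃ v j k →
    Σ[ m ] (λ t → Wat col r₁ r₂ r₃ v j t * + S t k)
      ≡ combo (r₁ + + 1) (r₂ + + 1) (c₀ n r₁ r₂ r₃) (r₃ + + 1)
          (Wat col (r₁ + + 1) (r₂ - + 1) r₃ v j k) (Wat col (r₁ - + 1) (r₂ + + 1) r₃ v j k)
          (Wat col r₁ r₂ (r₃ - + 1) v j k) (Wat col r₁ r₂ (r₃ + + 1) v j k)
  Wat-S‴ r₁ r₂ r₃ v j k =
    trans (Σ-cong m (λ t → cong (_* + S t k) (Wat-as-pairSum r₁ r₂ r₃ v j t)))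
    (trans (Σ-pairSum₃ j k (ofType r₁ r₂ r₃ v))
    (trans (pairSum-cong j k (∑-adj-ofType₃ r₁ r₂ r₃ v))
           (Wat-combo v j k (r₁ + + 1) (r₂ - + 1) r₃ (r₁ - + 1) (r₂ + + 1) r₃
                          r₁ r₂ (r₃ - + 1) r₁ r₂ (r₃ + + 1))))

  Wat-S″ : ∀ r₁ r₂ r₃ v j k →
    Σ[ m ] (λ t → Wat col r₁ r₂ r₃ v t k * + S t j)
      ≡ combo (r₁ + + 1) (r₃ + + 1) (c₀ n r₁ r₂ r₃) (r₂ + + 1)
          (Wat col (r₁ + + 1) r₂ (r₃ - + 1) v j k) (Wat col (r₁ - + 1) r₂ (r₃ + + 1) v j k)
          (Wat col r₁ (r₂ - + 1) r₃ v j k) (Wat col r₁ (r₂ + + 1) r₃ v j k)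
  Wat-S″ r₁ r₂ r₃ v j k =
    trans (Σ-cong m (λ t → cong (_* + S t j) (Wat-as-pairSum r₁ r₂ r₃ v t k)))
    (trans (Σ-pairSum₂ j k (ofType r₁ r₂ r₃ v))
    (trans (pairSum-cong j k (λ z y → ∑-adj-ofType₂ r₁ r₂ r₃ v y z))
           (Wat-combo v j k (r₁ + + 1) r₂ (r₃ - + 1) (r₁ - + 1) r₂ (r₃ + + 1)
                          r₁ (r₂ - + 1) r₃ r₁ (r₂ + + 1) r₃)))

  ∑-adj-Wat : ∀ r₁ r₂ r₃ v j k →
    ∑[ u ∈ cube ] adj v u * Wat col r₁ r₂ r₃ u j k
      ≡ combo (r₂ + + 1) (r₃ + + 1) (c₀ n r₁ r₂ r₃) (r₁ + + 1)
          (Wat col r₁ (r₂ + + 1) (r₃ - + 1) v j k) (Wat col r₁ (r₂ - + 1) (r₃ + + 1) v j k)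
          (Wat col (r₁ - + 1) r₂ r₃ v j k) (Wat col (r₁ + + 1) r₂ r₃ v j k)
  ∑-adj-Wat r₁ r₂ r₃ v j k =
    trans (∑-cong cube (λ u → cong (adj v u *_) (Wat-as-pairSum r₁ r₂ r₃ u j k)))
    (trans (∑-pairSum (adj v) j k (λ u → ofType r₁ r₂ r₃ u))
    (trans (pairSum-cong j k (λ x y → ∑-adj-ofType₁ r₁ r₂ r₃ x y v))
           (Wat-combo v j k r₁ (r₂ + + 1) (r₃ - + 1) r₁ (r₂ - + 1) (r₃ + + 1)
                          (r₁ - + 1) r₂ r₃ (r₁ + + 1) r₂ r₃)))

  T-combo : ∀ {a b c d} i j k p₁ p₂ p₃ q₁ q₂ q₃ s₁ s₂ s₃ u₁ u₂ u₃ →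
    ∑[ v ∈ cube ] cell i v * combo a b c d (Wat col p₁ p₂ p₃ v j k) (Wat col q₁ q₂ q₃ v j k)
                                           (Wat col s₁ s₂ s₃ v j k) (Wat col u₁ u₂ u₃ v j k)
      ≡ combo a b c d (T col p₁ p₂ p₃ i j k) (T col q₁ q₂ q₃ i j k)
                      (T col s₁ s₂ s₃ i j k) (T col u₁ u₂ u₃ i j k)
  T-combo {a} {b} {c} {d} i j k p₁ p₂ p₃ q₁ q₂ q₃ s₁ s₂ s₃ u₁ u₂ u₃ =
    trans (∑*-combo a b c d cube (cell i) _ _ _ _) (sym (combo-cong refl refl refl refl
      (T-as-∑ p₁ p₂ p₃ i j k) (T-as-∑ q₁ q₂ q₃ i j k)
      (T-as-∑ s₁ s₂ s₃ i j k) (T-as-∑ u₁ u₂ u₃ i j k)))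

  Σ-∑-cell : ∀ i (G : Word n → Fin m → ℤ) (s : Fin m → ℤ) →
    Σ[ m ] (λ t → (∑[ v ∈ cube ] cell i v * G v t) * s t)
      ≡ ∑[ v ∈ cube ] cell i v * Σ[ m ] (λ t → G v t * s t)
  Σ-∑-cell i G s = begin
      Σ[ m ] (λ t → (∑[ v ∈ cube ] cell i v * G v t) * s t)
    ≡⟨ trans (Σ≡∑ m _) (∑-cong (allFin m) (λ t → ℤ.*-comm _ (s t))) ⟩
      ∑[ t ∈ allFin m ] s t * (∑[ v ∈ cube ] cell i v * G v t)
    ≡⟨ ∑-swap* (allFin m) cube s (cell i) (λ t v → G v t) ⟩
      ∑[ v ∈ cube ] cell i v * (∑[ t ∈ allFin m ] s t * G v t)
    ≡⟨ ∑-cong cube (λ v → cong (cell i v *_)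
         (trans (∑-cong (allFin m) (λ t → ℤ.*-comm (s t) (G v t))) (sym (Σ≡∑ m _)))) ⟩
      ∑[ v ∈ cube ] cell i v * Σ[ m ] (λ t → G v t * s t) ∎
    where open ≡-Reasoning

  T-S‴ : ∀ r₁ r₂ r₃ i j k →
    Σ[ m ] (λ t → T col r₁ r₂ r₃ i j t * + S t k)
      ≡ combo (r₁ + + 1) (r₂ + + 1) (c₀ n r₁ r₂ r₃) (r₃ + + 1)
          (T col (r₁ + + 1) (r₂ - + 1) r₃ i j k) (T col (r₁ - + 1) (r₂ + + 1) r₃ i j k)
          (T col r₁ r₂ (r₃ - + 1) i j k) (T col r₁ r₂ (r₃ + + 1) i j k)
  T-S‴ r₁ r₂ r₃ i j k =
    trans (Σ-cong m (λ t → cong (_* + S t k) (T-as-∑ r₁ r₂ r₃ i j t)))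
    (trans (Σ-∑-cell i (λ v t → Wat col r₁ r₂ r₃ v j t) (λ t → + S t k))
    (trans (∑-cong cube (λ v → cong (cell i v *_) (Wat-S‴ r₁ r₂ r₃ v j k)))
           (T-combo i j k (r₁ + + 1) (r₂ - + 1) r₃ (r₁ - + 1) (r₂ + + 1) r₃
                          r₁ r₂ (r₃ - + 1) r₁ r₂ (r₃ + + 1))))

  T-S″ : ∀ r₁ r₂ r₃ i j k →
    Σ[ m ] (λ t → T col r₁ r₂ r₃ i t k * + S t j)
      ≡ combo (r₁ + + 1) (r₃ + + 1) (c₀ n r₁ r₂ r₃) (r₂ + + 1)
          (T col (r₁ + + 1) r₂ (r₃ - + 1) i j k) (T col (r₁ - + 1) r₂ (r₃ + + 1) i j k)
          (T col r₁ (r₂ - + 1) r₃ i j k) (T col r₁ (r₂ + + 1) r₃ i j k)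
  T-S″ r₁ r₂ r₃ i j k =
    trans (Σ-cong m (λ t → cong (_* + S t j) (T-as-∑ r₁ r₂ r₃ i t k)))
    (trans (Σ-∑-cell i (λ v t → Wat col r₁ r₂ r₃ v t k) (λ t → + S t j))
    (trans (∑-cong cube (λ v → cong (cell i v *_) (Wat-S″ r₁ r₂ r₃ v j k)))
           (T-combo i j k (r₁ + + 1) r₂ (r₃ - + 1) (r₁ - + 1) r₂ (r₃ + + 1)
                          r₁ (r₂ - + 1) r₃ r₁ (r₂ + + 1) r₃)))

  T-S′ : ∀ r₁ r₂ r₃ i j k →
    Σ[ m ] (λ t → T col r₁ r₂ r₃ t j k * + S t i)
      ≡ combo (r₂ + + 1) (r₃ + + 1) (c₀ n r₁ r₂ r₃) (r₁ + + 1)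
          (T col r₁ (r₂ + + 1) (r₃ - + 1) i j k) (T col r₁ (r₂ - + 1) (r₃ + + 1) i j k)
          (T col (r₁ - + 1) r₂ r₃ i j k) (T col (r₁ + + 1) r₂ r₃ i j k)
  T-S′ r₁ r₂ r₃ i j k =
    trans (Σ-cong m (λ t → cong (_* + S t i) (T-as-∑ r₁ r₂ r₃ t j k)))
    (trans (∑-quotient (λ v → Wat col r₁ r₂ r₃ v j k) i)
    (trans (∑-cong cube (λ z → cong (cell i z *_) (∑-adj-Wat r₁ r₂ r₃ z j k)))
           (T-combo i j k r₁ (r₂ + + 1) (r₃ - + 1) r₁ (r₂ - + 1) (r₃ + + 1)
                          (r₁ - + 1) r₂ r₃ (r₁ + + 1) r₂ r₃)))

  pairSum-zero : ∀ j k {F : Word n → Word n → ℤ} → (∀ x y → F x y ≡ + 0) → pairSum j k F ≡ + 0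
  pairSum-zero j k F≡0 = trans (∑-cong cube (λ x → trans (cong (cell j x *_)
    (trans (∑-cong cube (λ y → trans (cong (cell k y *_) (F≡0 x y)) (ℤ.*-zeroʳ (cell k y)))) (∑-zero cube)))
    (ℤ.*-zeroʳ (cell j x)))) (∑-zero cube)

  Wat-base : ∀ v j k → Wat col (+ 0) (+ 0) (+ 0) v j k ≡ cell j v * cell k v
  Wat-base v j k = begin
      Wat col (+ 0) (+ 0) (+ 0) v j k
    ≡⟨ Wat-as-pairSum (+ 0) (+ 0) (+ 0) v j k ⟩
      pairSum j k (ofType (+ 0) (+ 0) (+ 0) v)
    ≡⟨ pairSum-cong j k (λ x y → trans (type-zero (count odd₁ v x y) (count odd₂ v x y) (count odd₃ v x y))
         (sym (cong₂ (λ d d′ → + 𝟙 (d ℕ.≟ 0) * + 𝟙 (d′ ℕ.≟ 0)) (dist-count₁₂ v x y) (dist-count₁₃ v x y)))) ⟩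
      ∑[ x ∈ cube ] cell j x * (∑[ y ∈ cube ] cell k y * (δʷ v x * δʷ v y))
    ≡⟨ ∑-cong cube (λ x → cong (cell j x *_) (trans
         (∑-cong cube (λ y → exchange (cell k y) (δʷ v x) (δʷ v y)))
         (trans (sym (*-distribˡ-∑ (δʷ v x) cube _))
                (cong (δʷ v x *_) (trans (∑-cong cube (λ y → ℤ.*-comm (cell k y) (δʷ v y)))
                                         (∑-δʷ n v (cell k))))))) ⟩
      ∑[ x ∈ cube ] cell j x * (δʷ v x * cell k v)
    ≡⟨ ∑-cong cube (λ x → exchange (cell j x) (δʷ v x) (cell k v)) ⟩
      ∑[ x ∈ cube ] δʷ v x * (cell j x * cell k v)
    ≡⟨ ∑-δʷ n v (λ x → cell j x * cell k v) ⟩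
      cell j v * cell k v ∎
    where
    open ≡-Reasoning
    exchange : ∀ a b c → a * (b * c) ≡ b * (a * c)
    exchange = solve-∀
    type-zero : ∀ t₁ t₂ t₃ → δ³ (+ 0) (+ 0) (+ 0) t₁ t₂ t₃ ≡ + 𝟙 (t₁ ℕ.+ t₂ ℕ.≟ 0) * + 𝟙 (t₁ ℕ.+ t₃ ℕ.≟ 0)
    type-zero zero    zero    zero    = refl
    type-zero zero    zero    (suc _) = refl
    type-zero zero    (suc _) zero    = refl
    type-zero zero    (suc _) (suc _) = refl
    type-zero (suc _) _       _       = refl

  Invariant : ℤ → ℤ → ℤ → Set
  Invariant r₁ r₂ r₃ = ∀ v v′ → col v ≡ col v′ → ∀ j k → Wat col r₁ r₂ r₃ v j k ≡ Wat col r₁ r₂ r₃ v′ j k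

  vanishing⇒invariant : ∀ r₁ r₂ r₃ → (∀ v x y → ofType r₁ r₂ r₃ v x y ≡ + 0) → Invariant r₁ r₂ r₃
  vanishing⇒invariant r₁ r₂ r₃ type≡0 v v′ _ j k = trans (vanish v) (sym (vanish v′))
    where
    vanish : ∀ v → Wat col r₁ r₂ r₃ v j k ≡ + 0
    vanish v = trans (Wat-as-pairSum r₁ r₂ r₃ v j k) (pairSum-zero j k (type≡0 v))

  invariant-base : Invariant (+ 0) (+ 0) (+ 0)
  invariant-base v v′ e j k = trans (Wat-base v j k)
    (trans (cong (λ c → + 𝟙 (c ≟F j) * + 𝟙 (c ≟F k)) e) (sym (Wat-base v′ j k)))

  level : ℤ → ℤ → ℤ → ℤ
  level r₁ r₂ r₃ = r₃ + (r₂ + r₁)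

  Below : ℤ → ℤ → ℤ → Set
  Below r₁ r₂ r₃ = ∀ s₁ s₂ s₃ → level s₁ s₂ s₃ ≤ level r₁ r₂ r₃ → Invariant s₁ s₂ s₃

  ≤-minus-one : ∀ {x y} → x ≡ y - + 1 → x ≤ y
  ≤-minus-one e = ℤ.≤-trans (ℤ.≤-reflexive e) (ℤ.i≤j⇒i-k≤j (+ 1) ℤ.≤-refl)

  raise₃ : ∀ r₁ r₂ r₃ d → r₃ + + 1 ≡ + suc d → Below r₁ r₂ r₃ → Invariant r₁ r₂ (r₃ + + 1)
  raise₃ r₁ r₂ r₃ d nonzero below v v′ e j k = combo-injective₄ d nonzero
    (trans (sym (Wat-S‴ r₁ r₂ r₃ v j k))
      (trans (Σ-cong m (λ t → cong (_* + S t k) (below r₁ r₂ r₃ ℤ.≤-refl v v′ e j t)))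
             (Wat-S‴ r₁ r₂ r₃ v′ j k)))
    (below (r₁ + + 1) (r₂ - + 1) r₃ (ℤ.≤-reflexive (level₁ r₁ r₂ r₃)) v v′ e j k)
    (below (r₁ - + 1) (r₂ + + 1) r₃ (ℤ.≤-reflexive (level₂ r₁ r₂ r₃)) v v′ e j k)
    (below r₁ r₂ (r₃ - + 1) (≤-minus-one (level₃ r₁ r₂ r₃)) v v′ e j k)
    where
    level₁ : ∀ r₁ r₂ r₃ → r₃ + ((r₂ - + 1) + (r₁ + + 1)) ≡ r₃ + (r₂ + r₁)
    level₁ = solve-∀
    level₂ : ∀ r₁ r₂ r₃ → r₃ + ((r₂ + + 1) + (r₁ - + 1)) ≡ r₃ + (r₂ + r₁)
    level₂ = solve-∀
    level₃ : ∀ r₁ r₂ r₃ → (r₃ - + 1) + (r₂ + r₁) ≡ r₃ + (r₂ + r₁) - + 1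
    level₃ = solve-∀

  raise₂ : ∀ r₁ r₂ r₃ d → r₂ + + 1 ≡ + suc d → Below r₁ r₂ r₃ → Invariant r₁ (r₂ + + 1) r₃
  raise₂ r₁ r₂ r₃ d nonzero below v v′ e j k = combo-injective₄ d nonzero
    (trans (sym (Wat-S″ r₁ r₂ r₃ v j k))
      (trans (Σ-cong m (λ t → cong (_* + S t j) (below r₁ r₂ r₃ ℤ.≤-refl v v′ e t k)))
             (Wat-S″ r₁ r₂ r₃ v′ j k)))
    (below (r₁ + + 1) r₂ (r₃ - + 1) (ℤ.≤-reflexive (level₁ r₁ r₂ r₃)) v v′ e j k)
    (below (r₁ - + 1) r₂ (r₃ + + 1) (ℤ.≤-reflexive (level₂ r₁ r₂ r₃)) v v′ e j k)
    (below r₁ (r₂ - + 1) r₃ (≤-minus-one (level₃ r₁ r₂ r₃)) v v′ e j k)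
    where
    level₁ : ∀ r₁ r₂ r₃ → (r₃ - + 1) + (r₂ + (r₁ + + 1)) ≡ r₃ + (r₂ + r₁)
    level₁ = solve-∀
    level₂ : ∀ r₁ r₂ r₃ → (r₃ + + 1) + (r₂ + (r₁ - + 1)) ≡ r₃ + (r₂ + r₁)
    level₂ = solve-∀
    level₃ : ∀ r₁ r₂ r₃ → r₃ + ((r₂ - + 1) + r₁) ≡ r₃ + (r₂ + r₁) - + 1
    level₃ = solve-∀

  module WithRepresentatives (rep : Fin m → Word n) (rep-in : ∀ i → col (rep i) ≡ i) where

    ∑-adj-Wat-cellwise : ∀ r₁ r₂ r₃ → Invariant r₁ r₂ r₃ → ∀ v j k →
      ∑[ u ∈ cube ] adj v u * Wat col r₁ r₂ r₃ u j k
        ≡ Σ[ m ] (λ t → Wat col r₁ r₂ r₃ (rep t) j k * + S (col v) t)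
    ∑-adj-Wat-cellwise r₁ r₂ r₃ inv v j k = ∑-adj-cellwise v (λ u → Wat col r₁ r₂ r₃ u j k)
      (λ t → Wat col r₁ r₂ r₃ (rep t) j k) (λ u → inv u (rep (col u)) (sym (rep-in (col u))) j k)

    raise₁ : ∀ r₁ r₂ r₃ d → r₁ + + 1 ≡ + suc d → Below r₁ r₂ r₃ → Invariant (r₁ + + 1) r₂ r₃
    raise₁ r₁ r₂ r₃ d nonzero below v v′ e j k = combo-injective₄ d nonzero
      (trans (sym (∑-adj-Wat r₁ r₂ r₃ v j k))
        (trans (∑-adj-Wat-cellwise r₁ r₂ r₃ inv v j k)
          (trans (cong (λ c → Σ[ m ] (λ t → Wat col r₁ r₂ r₃ (rep t) j k * + S c t)) e)
            (trans (sym (∑-adj-Wat-cellwise r₁ r₂ r₃ inv v′ j k)) (∑-adj-Wat r₁ r₂ r₃ v′ j k)))))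
      (below r₁ (r₂ + + 1) (r₃ - + 1) (ℤ.≤-reflexive (level₁ r₁ r₂ r₃)) v v′ e j k)
      (below r₁ (r₂ - + 1) (r₃ + + 1) (ℤ.≤-reflexive (level₂ r₁ r₂ r₃)) v v′ e j k)
      (below (r₁ - + 1) r₂ r₃ (≤-minus-one (level₃ r₁ r₂ r₃)) v v′ e j k)
      where
      inv = below r₁ r₂ r₃ ℤ.≤-refl
      level₁ : ∀ r₁ r₂ r₃ → (r₃ - + 1) + ((r₂ + + 1) + r₁) ≡ r₃ + (r₂ + r₁)
      level₁ = solve-∀
      level₂ : ∀ r₁ r₂ r₃ → (r₃ + + 1) + ((r₂ - + 1) + r₁) ≡ r₃ + (r₂ + r₁)
      level₂ = solve-∀
      level₃ : ∀ r₁ r₂ r₃ → r₃ + (r₂ + (r₁ - + 1)) ≡ r₃ + (r₂ + r₁) - + 1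
      level₃ = solve-∀

    -- Recursion on the bound L: each raise only uses triples of lower level.
    invariant-below : ∀ L r₁ r₂ r₃ → level r₁ r₂ r₃ ≤ + L → Invariant r₁ r₂ r₃
    invariant-below L -[1+ a ] r₂ r₃  _ = vanishing⇒invariant -[1+ a ] r₂ r₃ (ofType-neg₁ a r₂ r₃)
    invariant-below L (+ a) -[1+ b ] r₃ _ = vanishing⇒invariant (+ a) -[1+ b ] r₃ (ofType-neg₂ (+ a) b r₃)
    invariant-below L (+ a) (+ b) -[1+ c ] _ = vanishing⇒invariant (+ a) (+ b) -[1+ c ] (ofType-neg₃ (+ a) (+ b) c)
    invariant-below L (+ 0) (+ 0) (+ 0) _ = invariant-base
    invariant-below zero (+ a) (+ b) (+ suc c) (+≤+ ())
    invariant-below zero (+ a) (+ suc b) (+ 0) (+≤+ ())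
    invariant-below zero (+ suc a) (+ 0) (+ 0) (+≤+ ())
    invariant-below (suc L) (+ a) (+ b) (+ suc c) (+≤+ (s≤s h)) =
      subst (Invariant (+ a) (+ b)) (ℤ.+-comm (+ c) (+ 1))
        (raise₃ (+ a) (+ b) (+ c) c (ℤ.+-comm (+ c) (+ 1))
          (λ s₁ s₂ s₃ h′ → invariant-below L s₁ s₂ s₃ (ℤ.≤-trans h′ (+≤+ h))))
    invariant-below (suc L) (+ a) (+ suc b) (+ 0) (+≤+ (s≤s h)) =
      subst (λ r₂ → Invariant (+ a) r₂ (+ 0)) (ℤ.+-comm (+ b) (+ 1))
        (raise₂ (+ a) (+ b) (+ 0) b (ℤ.+-comm (+ b) (+ 1))
          (λ s₁ s₂ s₃ h′ → invariant-below L s₁ s₂ s₃ (ℤ.≤-trans h′ (+≤+ h))))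
    invariant-below (suc L) (+ suc a) (+ 0) (+ 0) (+≤+ (s≤s h)) =
      subst (λ r₁ → Invariant r₁ (+ 0) (+ 0)) (ℤ.+-comm (+ a) (+ 1))
        (raise₁ (+ a) (+ 0) (+ 0) a (ℤ.+-comm (+ a) (+ 1))
          (λ s₁ s₂ s₃ h′ → invariant-below L s₁ s₂ s₃ (ℤ.≤-trans h′ (+≤+ h))))

    invariant : ∀ r₁ r₂ r₃ → Invariant r₁ r₂ r₃
    invariant r₁ r₂ r₃ = invariant-below ∣ level r₁ r₂ r₃ ∣ r₁ r₂ r₃ (≤-abs (level r₁ r₂ r₃))
      where
      ≤-abs : ∀ i → i ≤ + ∣ i ∣
      ≤-abs (+ _)      = ℤ.≤-refl
      ≤-abs -[1+ _ ] = -≤+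

    W-S′ᵀ : ∀ r₁ r₂ r₃ i j k →
      Σ[ m ] (λ t → Wat col r₁ r₂ r₃ (rep t) j k * + S i t)
        ≡ combo (r₂ + + 1) (r₃ + + 1) (c₀ n r₁ r₂ r₃) (r₁ + + 1)
            (Wat col r₁ (r₂ + + 1) (r₃ - + 1) (rep i) j k) (Wat col r₁ (r₂ - + 1) (r₃ + + 1) (rep i) j k)
            (Wat col (r₁ - + 1) r₂ r₃ (rep i) j k) (Wat col (r₁ + + 1) r₂ r₃ (rep i) j k)
    W-S′ᵀ r₁ r₂ r₃ i j k =
      trans (cong (λ c → Σ[ m ] (λ t → Wat col r₁ r₂ r₃ (rep t) j k * + S c t)) (sym (rep-in i)))
      (trans (sym (∑-adj-Wat-cellwise r₁ r₂ r₃ (invariant r₁ r₂ r₃) (rep i) j k))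
             (∑-adj-Wat r₁ r₂ r₃ (rep i) j k))

theorem2 : (n m : ℕ) (col : Word n → Fin m) (S : Fin m → Fin m → ℕ)
  → IsEquitable col S
  → (rep : Fin m → Word n) → (∀ i → col (rep i) ≡ i)
  → (r₁ r₂ r₃ : ℤ)
  → let Wv = W col rep
        Tv = T col
        c = + n - r₁ - r₂ - r₃ + + 1
    in (∀ i j k → (Wv r₁ r₂ r₃ ·S‴ S) i j k
          ≡ (r₁ + + 1) * Wv (r₁ + + 1) (r₂ - + 1) r₃ i j k
            + (r₂ + + 1) * Wv (r₁ - + 1) (r₂ + + 1) r₃ i j k
            + c * Wv r₁ r₂ (r₃ - + 1) i j k
            + (r₃ + + 1) * Wv r₁ r₂ (r₃ + + 1) i j k)
     × (∀ i j k → (Wv r₁ r₂ r₃ ·S″ S) i j k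
          ≡ (r₁ + + 1) * Wv (r₁ + + 1) r₂ (r₃ - + 1) i j k
            + (r₃ + + 1) * Wv (r₁ - + 1) r₂ (r₃ + + 1) i j k
            + c * Wv r₁ (r₂ - + 1) r₃ i j k
            + (r₂ + + 1) * Wv r₁ (r₂ + + 1) r₃ i j k)
     × (∀ i j k → (Wv r₁ r₂ r₃ ·S′ᵀ S) i j k
          ≡ (r₂ + + 1) * Wv r₁ (r₂ + + 1) (r₃ - + 1) i j k
            + (r₃ + + 1) * Wv r₁ (r₂ - + 1) (r₃ + + 1) i j k
            + c * Wv (r₁ - + 1) r₂ r₃ i j k
            + (r₁ + + 1) * Wv (r₁ + + 1) r₂ r₃ i j k)
     × (∀ i j k → (Tv r₁ r₂ r₃ ·S‴ S) i j k
          ≡ (r₁ + + 1) * Tv (r₁ + + 1) (r₂ - + 1) r₃ i j k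
            + (r₂ + + 1) * Tv (r₁ - + 1) (r₂ + + 1) r₃ i j k
            + c * Tv r₁ r₂ (r₃ - + 1) i j k
            + (r₃ + + 1) * Tv r₁ r₂ (r₃ + + 1) i j k)
     × (∀ i j k → (Tv r₁ r₂ r₃ ·S″ S) i j k
          ≡ (r₁ + + 1) * Tv (r₁ + + 1) r₂ (r₃ - + 1) i j k
            + (r₃ + + 1) * Tv (r₁ - + 1) r₂ (r₃ + + 1) i j k
            + c * Tv r₁ (r₂ - + 1) r₃ i j k
            + (r₂ + + 1) * Tv r₁ (r₂ + + 1) r₃ i j k)
     × (∀ i j k → (Tv r₁ r₂ r₃ ·S′ S) i j k
          ≡ (r₂ + + 1) * Tv r₁ (r₂ + + 1) (r₃ - + 1) i j k
            + (r₃ + + 1) * Tv r₁ (r₂ - + 1) (r₃ + + 1) i j k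
            + c * Tv (r₁ - + 1) r₂ r₃ i j k
            + (r₁ + + 1) * Tv (r₁ + + 1) r₂ r₃ i j k)
theorem2 n m col S equitable rep rep-in r₁ r₂ r₃ =
    (λ i j k → unfold-combo (Wat-S‴ r₁ r₂ r₃ (rep i) j k))
  , (λ i j k → unfold-combo (Wat-S″ r₁ r₂ r₃ (rep i) j k))
  , (λ i j k → unfold-combo (W-S′ᵀ r₁ r₂ r₃ i j k))
  , (λ i j k → unfold-combo (T-S‴ r₁ r₂ r₃ i j k))
  , (λ i j k → unfold-combo (T-S″ r₁ r₂ r₃ i j k))
  , (λ i j k → unfold-combo (T-S′ r₁ r₂ r₃ i j k))
  where
  open Equitable col S equitable
  open WithRepresentatives rep rep-in
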